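{- Let $\Sigma=\{A,C,G,T\}$, $\ell\ge1$, and let $\mathcal{C}$ be an $(n,k)$ code, i.e. an injective encoding map $(\Sigma^\ell)^k\to(\Sigma^\ell)^n$, $\mathcal{U}=(\mathbf{u}_1,\ldots,\mathbf{u}_k)\mapsto\mathcal{X}=(\mathbf{x}_1,\ldots,\mathbf{x}_n)$. For $i\in[k]$, $J\subseteq[n]$ is a retrieval set of $\mathbf{u}_i$ if there is a function $g$ with $\mathbf{u}_i=g((\mathbf{x}_j)_{j\in J})$ for all $\mathcal{U}$; $\mathcal{D}(i)$ is the set of inclusion-minimal retrieval sets of $\mathbf{u}_i$. Indices in $[n]$ are drawn independently and uniformly at random with replacement, and $\tau_i(\mathcal{C})$ is the smallest $r$ such that the set of indices drawn in the first $r$ draws is a retrieval set of $\mathbf{u}_i$. If for some $i\in[k]$, $\mathcal{D}(i)=\{A_1,\ldots,A_v\}$ with the $A_j$ mutually disjoint, then $$\mathbb{E}[\tau_i(\mathcal{C})]=n\sum_{s=1}^{v}(-1)^{s+1}\sum_{1\le j_1<\cdots<j_s\le v}H_{|A_{j_1}|+\cdots+|A_{j_s}|},$$ where $H_m=\sum_{j=1}^m\frac1j$. -}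

module Defs where

open import Data.Nat as ℕ using (ℕ; zero; suc; _<_; _≤_)
open import Data.Nat.Properties using (m^n≢0)
open import Data.Integer as ℤ using (ℤ; +_)
open import Data.Rational as ℚ using (ℚ; 0ℚ; 1ℚ; _+_; _*_; -_)
open import Data.Fin using (Fin)
open import Data.Fin.Subset using (Subset; _∈_; _⊆_; ⁅_⁆; _∪_; ⊥; ∣_∣)
open import Data.Vec using (Vec; lookup; []; _∷_)
import Data.Vec as V
open import Data.List as List using (List; []; _∷_; take; filter; length; concatMap; upTo)
open import Data.Bool using (Bool; true; false; _∧_; not; _∨_; T?)
open import Data.Product using (Σ; _×_)
open import Relation.Binary.PropositionalEquality using (_≡_)
open import Relation.Nullary using (Dec; ¬_)
open import Relation.Nullary.Decidable using (⌊_⌋)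
open import Data.Fin using () renaming (zero to fzero; suc to fsuc)

data Nucleotide : Set where
  A C G T : Nucleotide

Word : ℕ → Set
Word ℓ = Vec Nucleotide ℓ

Encoder : ℕ → ℕ → ℕ → Set
Encoder ℓ k n = Vec (Word ℓ) k → Vec (Word ℓ) n

Injective : ∀ {ℓ k n} → Encoder ℓ k n → Set
Injective enc = ∀ U U′ → enc U ≡ enc U′ → U ≡ U′

IsRetrieval : ∀ {ℓ k n} → Encoder ℓ k n → Fin k → Subset n → Set
IsRetrieval {ℓ} {k} {n} enc i J =
  Σ (((j : Fin n) → j ∈ J → Word ℓ) → Word ℓ) λ g →
    ∀ (U : Vec (Word ℓ) k) → lookup U i ≡ g (λ j _ → lookup (enc U) j)

IsMinimalRetrieval : ∀ {ℓ k n} → Encoder ℓ k n → Fin k → Subset n → Set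
IsMinimalRetrieval enc i J =
  IsRetrieval enc i J × (∀ B → B ⊆ J → IsRetrieval enc i B → B ≡ J)

drawn : ∀ {n} → List (Fin n) → Subset n
drawn []       = ⊥
drawn (x ∷ xs) = ⁅ x ⁆ ∪ drawn xs

allFin : (n : ℕ) → List (Fin n)
allFin zero    = []
allFin (suc n) = fzero ∷ List.map fsuc (allFin n)

allSeqs : (n r : ℕ) → List (List (Fin n))
allSeqs n zero    = [] ∷ []
allSeqs n (suc r) = concatMap (λ x → List.map (x ∷_) (allSeqs n r)) (allFin n)

module _ {n : ℕ} (isRet : Subset n → Bool) where
  -- "the first m draws already form a retrieval set" for some m < r
  hitBefore : List (Fin n) → ℕ → Bool
  hitBefore s zero    = false
  hitBefore s (suc m) = hitBefore s m ∨ isRet (drawn (take m s))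

  -- τ = r for a draw sequence s of length r: first r draws form a retrieval set,
  -- and for no smaller m the first m draws do.
  stopsAt : ℕ → List (Fin n) → Bool
  stopsAt r s = isRet (drawn s) ∧ not (hitBefore s r)

  countStop : ℕ → ℕ
  countStop r = length (filter (λ s → T? (stopsAt r s)) (allSeqs n r))

-- c / n^r as a rational (only used with n ≥ 1; returns 0 when n = 0)
probOf : ℕ → ℕ → ℕ → ℚ
probOf c zero    r = 0ℚ
probOf c (suc m) r = (+ c) ℚ./ (suc m ℕ.^ r) where instance _ = m^n≢0 (suc m) r

-- Partial sums  Σ_{r=0}^{M-1} r · P(τ_i = r)  of the expectation series
partialExpectation : ∀ {ℓ k n} (enc : Encoder ℓ k n) (i : Fin k) →
  (∀ J → Dec (IsRetrieval enc i J)) → ℕ → ℚ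
partialExpectation {n = n} enc i dec zero    = 0ℚ
partialExpectation {n = n} enc i dec (suc M) =
  partialExpectation enc i dec M +
  ((+ M) ℚ./ 1) * probOf (countStop (λ J → ⌊ dec J ⌋) M) n M

H : ℕ → ℚ
H zero    = 0ℚ
H (suc m) = H m + ((+ 1) ℚ./ suc m)

sumℚ : List ℚ → ℚ
sumℚ = List.foldr _+_ 0ℚ

allSubsets : (v : ℕ) → List (Subset v)
allSubsets zero    = V.[] ∷ []
allSubsets (suc v) = List.concatMap (λ S → (true V.∷ S) ∷ (false V.∷ S) ∷ []) (allSubsets v)

sizeSum : ∀ {v n} → (Fin v → Subset n) → Subset v → ℕ
sizeSum {zero}  Aₛ []             = 0
sizeSum {suc v} Aₛ (true  ∷ S) = ∣ Aₛ fzero ∣ ℕ.+ sizeSum (λ j → Aₛ (fsuc j)) S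
sizeSum {suc v} Aₛ (false ∷ S) = sizeSum (λ j → Aₛ (fsuc j)) S

signOf : ℕ → ℚ
signOf zero    = - 1ℚ
signOf (suc s) = - signOf s

formula : (n v : ℕ) → (Fin v → Subset n) → ℚ
formula n v Aₛ = ((+ n) ℚ./ 1) *
  sumℚ (List.map (λ s → signOf s *
           sumℚ (List.map (λ S → H (sizeSum Aₛ S))
                  (filter (λ S → ∣ S ∣ ℕ.≟ s) (allSubsets v))))
        (List.map suc (upTo v)))

-- The retrieval sets of uᵢ are closed upwards and their minimal elements are A₁, …, A_v,
-- so J is a retrieval set iff it contains some Aⱼ. Inclusion–exclusion over S ⊆ [v] writes
-- "the drawn indices D do not form a retrieval set" as Σ_S (−1)^|S| [U_S ⊆ D] with
-- U_S = ⋃_{j∈S} Aⱼ, so the law of τᵢ is an alternating combination of coupon-collector laws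
-- for the sets U_S, whose sizes are Σ_{j∈S} |Aⱼ| by disjointness. If e_m(K) is the
-- probability that K draws from [n] miss one of m given indices, the m-coupon collector's
-- expectation truncated at K equals n·H_m − K·e_m(K) − Σ_{j≤m} (n/j)·e_j(K), and the union
-- bound e_m(K) ≤ m(1 − 1/n)^K makes the remainder vanish.

module Submission where

open import Defs hiding (A; C; G; T)
open import Data.Nat as ℕ using (ℕ; zero; suc; _≤_; _≥_; z≤n; s≤s; NonZero)
import Data.Nat.Properties as ℕP
open import Data.Nat.Tactic.RingSolver using (solve-∀)
import Data.Integer as ℤ
import Data.Integer.Properties as ℤP
open import Data.Rational as ℚ using (ℚ; 0ℚ; 1ℚ; _+_; _*_; -_; _-_; _/_; _<_; ∣_∣) renaming (_≤_ to _≤ℚ_)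
import Data.Rational.Properties as ℚP
import Data.Rational.Unnormalised as ℚᵘ
import Data.Rational.Unnormalised.Properties as ℚᵘP
open import Data.Rational.Solver using (module +-*-Solver)
open import Data.Fin using (Fin) renaming (zero to fzero; suc to fsuc)
open import Data.Fin.Properties using (any?; suc-injective)
open import Data.Fin.Subset using (Subset; _⊆_; _∪_; _∩_; _─_; ⊥; ⁅_⁆) renaming (∣_∣ to #_)
open import Data.Fin.Subset.Properties
  using (_∈?_; _⊆?_; ⊆-refl; ⊆-trans; ⊆-antisym; ⊆-min; ⊥⊆; p⊆p∪q; q⊆p∪q; x∈p∪q⁻; p─q⊆p; x∈p∧x≢y⇒x∈p-y;
         x∈p⇒∣p-x∣<∣p∣; ∣p∣≤n; ∣⊥∣≡0; ∪-assoc; ∪-identityˡ; ∪-identityʳ; ∩-zeroʳ; ∩-distribˡ-∪)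
open import Data.Vec using ([]; _∷_)
import Data.Vec.Properties as VP
open import Data.List as List using (List; []; _∷_; _++_; _∷ʳ_; concatMap; filter; length; take; upTo)
import Data.List.Properties as LP
open import Data.Bool using (Bool; true; false; _∧_; _∨_; not; T?; if_then_else_)
open import Data.Product using (∃; _×_; _,_; proj₁; proj₂)
open import Data.Empty using (⊥-elim)
open import Data.Sum using (_⊎_; inj₁; inj₂; [_,_]′)
open import Function using (_∘_)
open import Function.Bundles using (_⇔_; mk⇔)
open import Relation.Binary.PropositionalEquality
open import Relation.Nullary using (Dec; yes; no; does)
open import Relation.Nullary.Decidable using (⌊_⌋; _×-dec_; does-⇔; isYes≗does; dec-true; dec-false)
open import Relation.Unary using (Decidable)

open +-*-Solver

fromℕ : ℕ → ℚ
fromℕ zero    = 0ℚ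
fromℕ (suc k) = 1ℚ + fromℕ k

toℚᵘ-fromℕ : ∀ k → ℚ.toℚᵘ (fromℕ k) ℚᵘ.≃ ℚᵘ.mkℚᵘ (ℤ.+ k) 0
toℚᵘ-fromℕ zero    = ℚᵘ.*≡* refl
toℚᵘ-fromℕ (suc k) = ℚᵘP.≃-trans (ℚP.toℚᵘ-homo-+ 1ℚ (fromℕ k))
  (ℚᵘP.≃-trans (ℚᵘP.+-congʳ (ℚᵘ.mkℚᵘ (ℤ.+ 1) 0) (toℚᵘ-fromℕ k))
               (ℚᵘ.*≡* (cong (λ z → (ℤ.+ 1 ℤ.+ z) ℤ.* ℤ.+ 1) (ℤP.*-identityʳ (ℤ.+ k)))))

fromℕ≡/1 : ∀ k → fromℕ k ≡ ℤ.+ k / 1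
fromℕ≡/1 k = ℚP.toℚᵘ-injective
  (ℚᵘP.≃-trans (toℚᵘ-fromℕ k) (ℚᵘP.≃-sym (ℚP.toℚᵘ-fromℚᵘ (ℚᵘ.mkℚᵘ (ℤ.+ k) 0))))

fromℕ-+ : ∀ a b → fromℕ (a ℕ.+ b) ≡ fromℕ a + fromℕ b
fromℕ-+ zero    b = sym (ℚP.+-identityˡ (fromℕ b))
fromℕ-+ (suc a) b = trans (cong (1ℚ +_) (fromℕ-+ a b)) (sym (ℚP.+-assoc 1ℚ (fromℕ a) (fromℕ b)))

fromℕ-* : ∀ a b → fromℕ (a ℕ.* b) ≡ fromℕ a * fromℕ b
fromℕ-* zero    b = sym (ℚP.*-zeroˡ (fromℕ b))
fromℕ-* (suc a) b = begin
  fromℕ (b ℕ.+ a ℕ.* b)        ≡⟨ fromℕ-+ b (a ℕ.* b) ⟩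
  fromℕ b + fromℕ (a ℕ.* b)    ≡⟨ cong (fromℕ b +_) (fromℕ-* a b) ⟩
  fromℕ b + fromℕ a * fromℕ b  ≡⟨ solve 2 (λ x y → y :+ x :* y := (con 1ℚ :+ x) :* y) refl (fromℕ a) (fromℕ b) ⟩
  (1ℚ + fromℕ a) * fromℕ b     ∎
  where open ≡-Reasoning

fromℕ-∸ : ∀ a b → b ℕ.≤ a → fromℕ (a ℕ.∸ b) ≡ fromℕ a - fromℕ b
fromℕ-∸ a b b≤a = begin
  fromℕ (a ℕ.∸ b)                      ≡⟨ solve 2 (λ x y → x := (x :+ y) :- y) refl (fromℕ (a ℕ.∸ b)) (fromℕ b) ⟩
  (fromℕ (a ℕ.∸ b) + fromℕ b) - fromℕ b ≡⟨ cong (_- fromℕ b) (sym (fromℕ-+ (a ℕ.∸ b) b)) ⟩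
  fromℕ (a ℕ.∸ b ℕ.+ b) - fromℕ b       ≡⟨ cong (λ z → fromℕ z - fromℕ b) (ℕP.m∸n+n≡m b≤a) ⟩
  fromℕ a - fromℕ b                     ∎
  where open ≡-Reasoning

recip : (d : ℕ) → .{{NonZero d}} → ℚ
recip d = ℤ.+ 1 / d

/≡fromℕ*recip : ∀ c d .{{_ : NonZero d}} → ℤ.+ c / d ≡ fromℕ c * recip d
/≡fromℕ*recip c (suc d) = ℚP.toℚᵘ-injective (begin
  ℚ.toℚᵘ (ℤ.+ c / suc d)
    ≈⟨ ℚP.toℚᵘ-fromℚᵘ (ℚᵘ.mkℚᵘ (ℤ.+ c) d) ⟩
  ℚᵘ.mkℚᵘ (ℤ.+ c) d
    ≈⟨ ℚᵘ.*≡* (cong₂ ℤ._*_ (sym (ℤP.*-identityʳ (ℤ.+ c))) (cong ℤ.+_ (ℕP.*-identityˡ (suc d)))) ⟩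
  ℚᵘ.mkℚᵘ (ℤ.+ c) 0 ℚᵘ.* ℚᵘ.mkℚᵘ (ℤ.+ 1) d
    ≈⟨ ℚᵘP.*-cong (toℚᵘ-fromℕ c) (ℚP.toℚᵘ-fromℚᵘ (ℚᵘ.mkℚᵘ (ℤ.+ 1) d)) ⟨
  ℚ.toℚᵘ (fromℕ c) ℚᵘ.* ℚ.toℚᵘ (recip (suc d))
    ≈⟨ ℚP.toℚᵘ-homo-* (fromℕ c) (recip (suc d)) ⟨
  ℚ.toℚᵘ (fromℕ c * recip (suc d)) ∎)
  where open ℚᵘP.≃-Reasoning

fromℕ*recip : ∀ d .{{_ : NonZero d}} → fromℕ d * recip d ≡ 1ℚ
fromℕ*recip d = trans (sym (/≡fromℕ*recip d d)) (d/d≡1 d)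
  where
  d/d≡1 : ∀ d .{{_ : NonZero d}} → ℤ.+ d / d ≡ 1ℚ
  d/d≡1 (suc d) = ℚP.toℚᵘ-injective
    (ℚᵘP.≃-trans (ℚP.toℚᵘ-fromℚᵘ (ℚᵘ.mkℚᵘ (ℤ.+ suc d) d)) (ℚᵘ.*≡* (ℤP.*-comm (ℤ.+ suc d) (ℤ.+ 1))))

recip-unique : ∀ d .{{_ : NonZero d}} x → fromℕ d * x ≡ 1ℚ → x ≡ recip d
recip-unique d x dx≡1 = begin
  x                        ≡⟨ ℚP.*-identityʳ x ⟨
  x * 1ℚ                   ≡⟨ cong (x *_) (fromℕ*recip d) ⟨
  x * (fromℕ d * recip d)  ≡⟨ solve 3 (λ x a b → x :* (a :* b) := (a :* x) :* b) refl x (fromℕ d) (recip d) ⟩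
  (fromℕ d * x) * recip d  ≡⟨ cong (_* recip d) dx≡1 ⟩
  1ℚ * recip d             ≡⟨ ℚP.*-identityˡ (recip d) ⟩
  recip d                  ∎
  where open ≡-Reasoning

infixr 8 _^_
_^_ : ℚ → ℕ → ℚ
x ^ zero  = 1ℚ
x ^ suc r = x * x ^ r

1^ : ∀ r → 1ℚ ^ r ≡ 1ℚ
1^ zero    = refl
1^ (suc r) = trans (ℚP.*-identityˡ (1ℚ ^ r)) (1^ r)

^-distribʳ-* : ∀ x y r → (x * y) ^ r ≡ x ^ r * y ^ r
^-distribʳ-* x y zero    = sym (ℚP.*-identityˡ 1ℚ)
^-distribʳ-* x y (suc r) = trans (cong ((x * y) *_) (^-distribʳ-* x y r))
  (solve 4 (λ x y a b → (x :* y) :* (a :* b) := (x :* a) :* (y :* b)) refl x y (x ^ r) (y ^ r))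

fromℕ-^ : ∀ a r → fromℕ (a ℕ.^ r) ≡ fromℕ a ^ r
fromℕ-^ a zero    = ℚP.+-identityʳ 1ℚ
fromℕ-^ a (suc r) = trans (fromℕ-* a (a ℕ.^ r)) (cong (fromℕ a *_) (fromℕ-^ a r))

recip-^ : ∀ d .{{_ : NonZero d}} r → recip (d ℕ.^ r) {{ℕP.m^n≢0 d r}} ≡ recip d ^ r
recip-^ d r = sym (recip-unique (d ℕ.^ r) {{ℕP.m^n≢0 d r}} (recip d ^ r) (begin
  fromℕ (d ℕ.^ r) * recip d ^ r  ≡⟨ cong (_* recip d ^ r) (fromℕ-^ d r) ⟩
  fromℕ d ^ r * recip d ^ r      ≡⟨ ^-distribʳ-* (fromℕ d) (recip d) r ⟨
  (fromℕ d * recip d) ^ r        ≡⟨ cong (_^ r) (fromℕ*recip d) ⟩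
  1ℚ ^ r                         ≡⟨ 1^ r ⟩
  1ℚ                             ∎))
  where open ≡-Reasoning

probOf≡ : ∀ c n .{{_ : NonZero n}} r → probOf c n r ≡ fromℕ c * recip n ^ r
probOf≡ c (suc m) r = trans (/≡fromℕ*recip c (suc m ℕ.^ r) {{ℕP.m^n≢0 (suc m) r}})
                            (cong (fromℕ c *_) (recip-^ (suc m) r))

∑ : {X : Set} → List X → (X → ℚ) → ℚ
∑ []       f = 0ℚ
∑ (x ∷ xs) f = f x + ∑ xs f

infix 5 ∑
syntax ∑ L (λ x → e) = ∑[ x ← L ] e

module _ {X : Set} where

  sumℚ-map : ∀ (f : X → ℚ) xs → sumℚ (List.map f xs) ≡ ∑ xs f
  sumℚ-map f []       = refl
  sumℚ-map f (x ∷ xs) = cong (f x +_) (sumℚ-map f xs)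

  ∑-cong : ∀ {f g : X → ℚ} → (∀ x → f x ≡ g x) → ∀ xs → ∑ xs f ≡ ∑ xs g
  ∑-cong f≗g []       = refl
  ∑-cong f≗g (x ∷ xs) = cong₂ _+_ (f≗g x) (∑-cong f≗g xs)

  ∑-++ : ∀ (f : X → ℚ) xs ys → ∑ (xs ++ ys) f ≡ ∑ xs f + ∑ ys f
  ∑-++ f []       ys = sym (ℚP.+-identityˡ _)
  ∑-++ f (x ∷ xs) ys = trans (cong (f x +_) (∑-++ f xs ys)) (sym (ℚP.+-assoc (f x) _ _))

  ∑-0 : ∀ (xs : List X) → ∑[ x ← xs ] 0ℚ ≡ 0ℚ
  ∑-0 []       = refl
  ∑-0 (x ∷ xs) = trans (ℚP.+-identityˡ _) (∑-0 xs)

  ∑-const : ∀ c (xs : List X) → ∑[ x ← xs ] c ≡ fromℕ (length xs) * c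
  ∑-const c []       = sym (ℚP.*-zeroˡ c)
  ∑-const c (x ∷ xs) = trans (cong (c +_) (∑-const c xs))
    (solve 2 (λ c l → c :+ l :* c := (con 1ℚ :+ l) :* c) refl c (fromℕ (length xs)))

  ∑-+ : ∀ (f g : X → ℚ) xs → ∑[ x ← xs ] (f x + g x) ≡ ∑ xs f + ∑ xs g
  ∑-+ f g []       = sym (ℚP.+-identityˡ 0ℚ)
  ∑-+ f g (x ∷ xs) = trans (cong ((f x + g x) +_) (∑-+ f g xs))
    (solve 4 (λ a b c d → (a :+ b) :+ (c :+ d) := (a :+ c) :+ (b :+ d)) refl (f x) (g x) (∑ xs f) (∑ xs g))

  ∑-*ˡ : ∀ c (f : X → ℚ) xs → ∑[ x ← xs ] (c * f x) ≡ c * ∑ xs f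
  ∑-*ˡ c f []       = sym (ℚP.*-zeroʳ c)
  ∑-*ˡ c f (x ∷ xs) = trans (cong ((c * f x) +_) (∑-*ˡ c f xs)) (sym (ℚP.*-distribˡ-+ c (f x) (∑ xs f)))

  ∑-*ʳ : ∀ c (f : X → ℚ) xs → ∑[ x ← xs ] (f x * c) ≡ ∑ xs f * c
  ∑-*ʳ c f xs = trans (∑-cong (λ x → ℚP.*-comm (f x) c) xs) (trans (∑-*ˡ c f xs) (ℚP.*-comm c (∑ xs f)))

  ∑-neg : ∀ (f : X → ℚ) xs → ∑[ x ← xs ] (- f x) ≡ - ∑ xs f
  ∑-neg f []       = refl
  ∑-neg f (x ∷ xs) = trans (cong ((- f x) +_) (∑-neg f xs)) (sym (ℚP.neg-distrib-+ (f x) (∑ xs f)))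

  ∑-- : ∀ (f g : X → ℚ) xs → ∑[ x ← xs ] (f x - g x) ≡ ∑ xs f - ∑ xs g
  ∑-- f g xs = trans (∑-+ f (λ x → - g x) xs) (cong (∑ xs f +_) (∑-neg g xs))

  ∑-filter : ∀ {P : X → Set} (P? : Decidable P) (f : X → ℚ) xs →
    ∑ (filter P? xs) f ≡ ∑[ x ← xs ] (if does (P? x) then f x else 0ℚ)
  ∑-filter P? f []       = refl
  ∑-filter P? f (x ∷ xs) with does (P? x)
  ... | true  = cong (f x +_) (∑-filter P? f xs)
  ... | false = trans (∑-filter P? f xs) (sym (ℚP.+-identityˡ _))

module _ {X Y : Set} where

  ∑-map : ∀ (f : Y → ℚ) (g : X → Y) xs → ∑ (List.map g xs) f ≡ ∑[ x ← xs ] f (g x)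
  ∑-map f g []       = refl
  ∑-map f g (x ∷ xs) = cong (f (g x) +_) (∑-map f g xs)

  ∑-concatMap : ∀ (f : Y → ℚ) (g : X → List Y) xs → ∑ (concatMap g xs) f ≡ ∑[ x ← xs ] ∑ (g x) f
  ∑-concatMap f g []       = refl
  ∑-concatMap f g (x ∷ xs) = trans (∑-++ f (g x) (concatMap g xs)) (cong (∑ (g x) f +_) (∑-concatMap f g xs))

  ∑-comm : ∀ (f : X → Y → ℚ) xs ys → ∑[ x ← xs ] ∑[ y ← ys ] f x y ≡ ∑[ y ← ys ] ∑[ x ← xs ] f x y
  ∑-comm f []       ys = sym (∑-0 ys)
  ∑-comm f (x ∷ xs) ys = trans (cong (∑ ys (f x) +_) (∑-comm f xs ys))
    (sym (∑-+ (f x) (λ y → ∑[ x ← xs ] f x y) ys))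

𝟙 : Bool → ℚ
𝟙 true  = 1ℚ
𝟙 false = 0ℚ

fromℕ-count : ∀ {X : Set} (p : X → Bool) xs →
  fromℕ (length (filter (λ x → T? (p x)) xs)) ≡ ∑[ x ← xs ] 𝟙 (p x)
fromℕ-count p []       = refl
fromℕ-count p (x ∷ xs) with p x
... | true  = cong (1ℚ +_) (fromℕ-count p xs)
... | false = trans (fromℕ-count p xs) (sym (ℚP.+-identityˡ _))

-- Retrieval sets

module _ {ℓ k n} (enc : Encoder ℓ k n) (i : Fin k) where

  retrieval-⊆ : ∀ {B J} → B ⊆ J → IsRetrieval enc i B → IsRetrieval enc i J
  retrieval-⊆ B⊆J (g , g-retrieves) = (λ x → g (λ j j∈B → x j (B⊆J j∈B))) , g-retrieves

  module _ (dec : ∀ J → Dec (IsRetrieval enc i J)) where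

    minimal-retrieval-⊆ : ∀ m J → # J ℕ.< m → IsRetrieval enc i J →
                          ∃ λ B → B ⊆ J × IsMinimalRetrieval enc i B
    minimal-retrieval-⊆ (suc m) J #J<m J-ret
      with any? (λ x → (x ∈? J) ×-dec dec (J ─ ⁅ x ⁆))
    ... | yes (x , x∈J , J-x-ret) =
      let B , B⊆J-x , B-min = minimal-retrieval-⊆ m (J ─ ⁅ x ⁆)
                                (ℕP.<-≤-trans (x∈p⇒∣p-x∣<∣p∣ x∈J) (ℕP.≤-pred #J<m)) J-x-ret
      in B , ⊆-trans B⊆J-x (p─q⊆p J _) , B-min
    ... | no no-removable = J , ⊆-refl , J-ret , J-minimal
      where
      J-minimal : ∀ B → B ⊆ J → IsRetrieval enc i B → B ≡ J
      J-minimal B B⊆J B-ret = ⊆-antisym B⊆J J⊆B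
        where
        J⊆B : J ⊆ B
        J⊆B {y} y∈J with y ∈? B
        ... | yes y∈B = y∈B
        ... | no  y∉B = ⊥-elim (no-removable (y , y∈J , retrieval-⊆ B⊆J-y B-ret))
          where B⊆J-y : B ⊆ J ─ ⁅ y ⁆
                B⊆J-y {z} z∈B = x∈p∧x≢y⇒x∈p-y (B⊆J z∈B) (λ { refl → y∉B z∈B })

    module _ {v} (A : Fin v → Subset n)
             (A-minimal : ∀ j → IsMinimalRetrieval enc i (A j))
             (A-complete : ∀ B → IsMinimalRetrieval enc i B → ∃ λ j → B ≡ A j) where

      retrieval⇔⊇some : ∀ J → IsRetrieval enc i J ⇔ ∃ λ j → A j ⊆ J
      retrieval⇔⊇some J = mk⇔ ⊇some (λ (j , Aj⊆J) → retrieval-⊆ Aj⊆J (proj₁ (A-minimal j)))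
        where
        ⊇some : IsRetrieval enc i J → ∃ λ j → A j ⊆ J
        ⊇some J-ret with minimal-retrieval-⊆ (suc (# J)) J (ℕP.n<1+n _) J-ret
        ... | B , B⊆J , B-min with A-complete B B-min
        ... | j , refl = j , B⊆J

      ⌊retrieval⌋ : ∀ J → ⌊ dec J ⌋ ≡ does (any? (λ j → A j ⊆? J))
      ⌊retrieval⌋ J = trans (isYes≗does (dec J)) (does-⇔ (retrieval⇔⊇some J) (dec J) (any? (λ j → A j ⊆? J)))

-- Inclusion–exclusion

⋃ : ∀ {v n} → (Fin v → Subset n) → Subset v → Subset n
⋃ {zero}  A []          = ⊥
⋃ {suc v} A (true ∷ S)  = A fzero ∪ ⋃ (λ j → A (fsuc j)) S
⋃ {suc v} A (false ∷ S) = ⋃ (λ j → A (fsuc j)) S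

altSign : ∀ {v} → Subset v → ℚ
altSign []          = 1ℚ
altSign (true ∷ S)  = - altSign S
altSign (false ∷ S) = altSign S

∑-allSubsets-suc : ∀ v (f : Subset (suc v) → ℚ) →
  ∑ (allSubsets (suc v)) f ≡ ∑[ S ← allSubsets v ] (f (true ∷ S) + f (false ∷ S))
∑-allSubsets-suc v f = trans (∑-concatMap f _ (allSubsets v))
  (∑-cong (λ S → cong (f (true ∷ S) +_) (ℚP.+-identityʳ (f (false ∷ S)))) (allSubsets v))

∪⊆⇔ : ∀ {n} (P Q T : Subset n) → P ∪ Q ⊆ T ⇔ (P ⊆ T × Q ⊆ T)
∪⊆⇔ P Q T = mk⇔ split join
  where
  split : P ∪ Q ⊆ T → P ⊆ T × Q ⊆ T
  split P∪Q⊆T = (λ x∈P → P∪Q⊆T (p⊆p∪q Q x∈P)) , (λ x∈Q → P∪Q⊆T (q⊆p∪q P Q x∈Q))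
  join : P ⊆ T × Q ⊆ T → P ∪ Q ⊆ T
  join (P⊆T , Q⊆T) x∈P∪Q = [ P⊆T , Q⊆T ]′ (x∈p∪q⁻ P Q x∈P∪Q)

𝟙-∧ : ∀ a b → 𝟙 (a ∧ b) ≡ 𝟙 a * 𝟙 b
𝟙-∧ true  b = sym (ℚP.*-identityˡ (𝟙 b))
𝟙-∧ false b = sym (ℚP.*-zeroˡ (𝟙 b))

inclusion-exclusion : ∀ {v n} (A : Fin v → Subset n) T →
  𝟙 (not (does (any? (λ j → A j ⊆? T)))) ≡ ∑[ S ← allSubsets v ] altSign S * 𝟙 (does (⋃ A S ⊆? T))
inclusion-exclusion {zero} A T rewrite dec-true (⊥ ⊆? T) ⊥⊆ = refl
inclusion-exclusion {suc v} A T = sym (begin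
  ∑[ S ← allSubsets (suc v) ] altSign S * 𝟙 (does (⋃ A S ⊆? T))
    ≡⟨ ∑-allSubsets-suc v _ ⟩
  ∑[ S ← allSubsets v ] (- altSign S * 𝟙 (does (A fzero ∪ ⋃ A′ S ⊆? T)) + altSign S * 𝟙 (does (⋃ A′ S ⊆? T)))
    ≡⟨ ∑-cong split (allSubsets v) ⟩
  ∑[ S ← allSubsets v ] ((1ℚ - 𝟙 a) * (altSign S * 𝟙 (does (⋃ A′ S ⊆? T))))
    ≡⟨ ∑-*ˡ (1ℚ - 𝟙 a) _ (allSubsets v) ⟩
  (1ℚ - 𝟙 a) * (∑[ S ← allSubsets v ] altSign S * 𝟙 (does (⋃ A′ S ⊆? T)))
    ≡⟨ cong ((1ℚ - 𝟙 a) *_) (inclusion-exclusion A′ T) ⟨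
  (1ℚ - 𝟙 a) * 𝟙 (not b)
    ≡⟨ 𝟙-nor a b ⟩
  𝟙 (not (a ∨ b)) ∎)
  where
  open ≡-Reasoning
  A′ = λ j → A (fsuc j)
  a = does (A fzero ⊆? T)
  b = does (any? (λ j → A′ j ⊆? T))
  split : ∀ S → - altSign S * 𝟙 (does (A fzero ∪ ⋃ A′ S ⊆? T)) + altSign S * 𝟙 (does (⋃ A′ S ⊆? T)) ≡
                (1ℚ - 𝟙 a) * (altSign S * 𝟙 (does (⋃ A′ S ⊆? T)))
  split S rewrite does-⇔ (∪⊆⇔ (A fzero) (⋃ A′ S) T) (A fzero ∪ ⋃ A′ S ⊆? T) (A fzero ⊆? T ×-dec ⋃ A′ S ⊆? T)
                | 𝟙-∧ a (does (⋃ A′ S ⊆? T)) =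
    solve 3 (λ s x y → (:- s) :* (x :* y) :+ s :* y := (con 1ℚ :- x) :* (s :* y)) refl
      (altSign S) (𝟙 a) (𝟙 (does (⋃ A′ S ⊆? T)))
  𝟙-nor : ∀ a b → (1ℚ - 𝟙 a) * 𝟙 (not b) ≡ 𝟙 (not (a ∨ b))
  𝟙-nor true  b = solve 1 (λ x → (con 1ℚ :- con 1ℚ) :* x := con 0ℚ) refl (𝟙 (not b))
  𝟙-nor false b = ℚP.*-identityˡ _

length-allFin : ∀ n → length (allFin n) ≡ n
length-allFin zero    = refl
length-allFin (suc n) = cong suc (trans (LP.length-map fsuc (allFin n)) (length-allFin n))

∑-allFin-suc : ∀ n (f : Fin (suc n) → ℚ) → ∑ (allFin (suc n)) f ≡ f fzero + (∑[ x ← allFin n ] f (fsuc x))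
∑-allFin-suc n f = cong (f fzero +_) (∑-map f fsuc (allFin n))

∑-allFin-const : ∀ n c → ∑[ x ← allFin n ] c ≡ fromℕ n * c
∑-allFin-const n c = trans (∑-const c (allFin n)) (cong (λ k → fromℕ k * c) (length-allFin n))

∑-allSeqs-suc : ∀ n r (f : List (Fin n) → ℚ) →
  ∑ (allSeqs n (suc r)) f ≡ ∑[ x ← allFin n ] ∑[ s ← allSeqs n r ] f (x ∷ s)
∑-allSeqs-suc n r f = trans (∑-concatMap f _ (allFin n)) (∑-cong (λ x → ∑-map f (x ∷_) (allSeqs n r)) (allFin n))

∑-allSeqs-take : ∀ n r (f : List (Fin n) → ℚ) →
  ∑[ s ← allSeqs n (suc r) ] f (take r s) ≡ fromℕ n * ∑ (allSeqs n r) f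
∑-allSeqs-take n zero f = begin
  ∑[ s ← allSeqs n 1 ] f (take 0 s)     ≡⟨ ∑-allSeqs-suc n 0 (λ s → f (take 0 s)) ⟩
  ∑[ x ← allFin n ] (f [] + 0ℚ)         ≡⟨ ∑-allFin-const n (f [] + 0ℚ) ⟩
  fromℕ n * (f [] + 0ℚ)                 ∎
  where open ≡-Reasoning
∑-allSeqs-take n (suc r) f = begin
  ∑[ s ← allSeqs n (suc (suc r)) ] f (take (suc r) s)
    ≡⟨ ∑-allSeqs-suc n (suc r) _ ⟩
  ∑[ x ← allFin n ] ∑[ s ← allSeqs n (suc r) ] f (x ∷ take r s)
    ≡⟨ ∑-cong (λ x → ∑-allSeqs-take n r (λ s → f (x ∷ s))) (allFin n) ⟩
  ∑[ x ← allFin n ] (fromℕ n * (∑[ s ← allSeqs n r ] f (x ∷ s)))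
    ≡⟨ ∑-*ˡ (fromℕ n) _ (allFin n) ⟩
  fromℕ n * (∑[ x ← allFin n ] ∑[ s ← allSeqs n r ] f (x ∷ s))
    ≡⟨ cong (fromℕ n *_) (∑-allSeqs-suc n r f) ⟨
  fromℕ n * ∑ (allSeqs n (suc r)) f ∎
  where open ≡-Reasoning

-- missing U T = # (U ─ T), by a recursion that computes on cons cells.
missing : ∀ {n} → Subset n → Subset n → ℕ
missing []          []          = 0
missing (false ∷ U) (_ ∷ T)     = missing U T
missing (true ∷ U)  (true ∷ T)  = missing U T
missing (true ∷ U)  (false ∷ T) = suc (missing U T)

missing≤n : ∀ {n} (U T : Subset n) → missing U T ≤ n
missing≤n []          []          = ℕ.z≤n
missing≤n (false ∷ U) (_ ∷ T)     = ℕP.m≤n⇒m≤1+n (missing≤n U T)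
missing≤n (true ∷ U)  (true ∷ T)  = ℕP.m≤n⇒m≤1+n (missing≤n U T)
missing≤n (true ∷ U)  (false ∷ T) = ℕ.s≤s (missing≤n U T)

missing-⊥ : ∀ {n} (U : Subset n) → missing U ⊥ ≡ # U
missing-⊥ []          = refl
missing-⊥ (true ∷ U)  = cong suc (missing-⊥ U)
missing-⊥ (false ∷ U) = missing-⊥ U

private
  draw-keeps-missing : ∀ n (f : ℕ → ℚ) m → f m + (fromℕ m * f (ℕ.pred m) + (fromℕ n - fromℕ m) * f m) ≡
                                           fromℕ m * f (ℕ.pred m) + (fromℕ (suc n) - fromℕ m) * f m
  draw-keeps-missing n f m =
    solve 4 (λ a b c d → b :+ (c :* a :+ (d :- c) :* b) := c :* a :+ ((con 1ℚ :+ d) :- c) :* b) refl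
      (f (ℕ.pred m)) (f m) (fromℕ m) (fromℕ n)

∑-missing-after-draw : ∀ n (U T : Subset n) (f : ℕ → ℚ) → let m = missing U T in
  ∑[ x ← allFin n ] f (missing U (T ∪ ⁅ x ⁆)) ≡ fromℕ m * f (ℕ.pred m) + (fromℕ n - fromℕ m) * f m
∑-missing-after-draw zero [] [] f =
  solve 1 (λ a → con 0ℚ := con 0ℚ :* a :+ (con 0ℚ :- con 0ℚ) :* a) refl (f 0)
∑-missing-after-draw (suc n) (u ∷ U) (t ∷ T) f
  rewrite ∑-allFin-suc n (λ x → f (missing (u ∷ U) ((t ∷ T) ∪ ⁅ x ⁆))) | ∪-identityʳ T
  with u | t
... | false | false rewrite ∑-missing-after-draw n U T f = draw-keeps-missing n f (missing U T)
... | false | true  rewrite ∑-missing-after-draw n U T f = draw-keeps-missing n f (missing U T)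
... | true  | true  rewrite ∑-missing-after-draw n U T f = draw-keeps-missing n f (missing U T)
... | true  | false rewrite ∑-missing-after-draw n U T (λ k → f (suc k)) = head-missing (missing U T)
  where
  head-missing : ∀ m → f m + (fromℕ m * f (suc (ℕ.pred m)) + (fromℕ n - fromℕ m) * f (suc m)) ≡
                       fromℕ (suc m) * f m + (fromℕ (suc n) - fromℕ (suc m)) * f (suc m)
  head-missing zero = solve 3 (λ a b c → a :+ (con 0ℚ :* b :+ (c :- con 0ℚ) :* b)
                        := (con 1ℚ :+ con 0ℚ) :* a :+ ((con 1ℚ :+ c) :- (con 1ℚ :+ con 0ℚ)) :* b) refl (f 0) (f 1) (fromℕ n)
  head-missing (suc m) = solve 4 (λ a b c d → a :+ (d :* a :+ (c :- d) :* b)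
                           := (con 1ℚ :+ d) :* a :+ ((con 1ℚ :+ c) :- (con 1ℚ :+ d)) :* b) refl
                           (f (suc m)) (f (suc (suc m))) (fromℕ n) (fromℕ (suc m))

-- Sequences of r draws from [n] that miss one of m given indices, counted by the first draw.
missCount : ℕ → ℕ → ℕ → ℕ
missCount n zero    r       = 0
missCount n (suc m) zero    = 1
missCount n (suc m) (suc r) = suc m ℕ.* missCount n m r ℕ.+ (n ℕ.∸ suc m) ℕ.* missCount n (suc m) r

fromℕ-missCount-suc : ∀ n m r → suc m ≤ n → fromℕ (missCount n (suc m) (suc r)) ≡
  fromℕ (suc m) * fromℕ (missCount n m r) + (fromℕ n - fromℕ (suc m)) * fromℕ (missCount n (suc m) r)
fromℕ-missCount-suc n m r m<n = begin
  fromℕ (suc m ℕ.* a ℕ.+ (n ℕ.∸ suc m) ℕ.* b)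
    ≡⟨ fromℕ-+ (suc m ℕ.* a) ((n ℕ.∸ suc m) ℕ.* b) ⟩
  fromℕ (suc m ℕ.* a) + fromℕ ((n ℕ.∸ suc m) ℕ.* b)
    ≡⟨ cong₂ _+_ (fromℕ-* (suc m) a) (fromℕ-* (n ℕ.∸ suc m) b) ⟩
  fromℕ (suc m) * fromℕ a + fromℕ (n ℕ.∸ suc m) * fromℕ b
    ≡⟨ cong (λ z → fromℕ (suc m) * fromℕ a + z * fromℕ b) (fromℕ-∸ n (suc m) m<n) ⟩
  fromℕ (suc m) * fromℕ a + (fromℕ n - fromℕ (suc m)) * fromℕ b ∎
  where
  open ≡-Reasoning
  a = missCount n m r
  b = missCount n (suc m) r

missCount-after-draw : ∀ n (U T : Subset n) r →
  ∑[ x ← allFin n ] fromℕ (missCount n (missing U (T ∪ ⁅ x ⁆)) r) ≡ fromℕ (missCount n (missing U T) (suc r))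
missCount-after-draw n U T r rewrite ∑-missing-after-draw n U T (λ k → fromℕ (missCount n k r))
  with missing U T | missing≤n U T
... | zero  | _   = solve 1 (λ x → con 0ℚ :* con 0ℚ :+ (x :- con 0ℚ) :* con 0ℚ := con 0ℚ) refl (fromℕ n)
... | suc m | m<n = sym (fromℕ-missCount-suc n m r m<n)

𝟙-⊆-missCount : ∀ {n} N (U T : Subset n) → 𝟙 (does (U ⊆? T)) ≡ 1ℚ - fromℕ (missCount N (missing U T) 0)
𝟙-⊆-missCount N []          []          = refl
𝟙-⊆-missCount N (false ∷ U) (t ∷ T)     = 𝟙-⊆-missCount N U T
𝟙-⊆-missCount N (true ∷ U)  (true ∷ T)  = 𝟙-⊆-missCount N U T
𝟙-⊆-missCount N (true ∷ U)  (false ∷ T) = refl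

∪-monoʳ-⊆ : ∀ {n} (P : Subset n) {Q R} → Q ⊆ R → P ∪ Q ⊆ P ∪ R
∪-monoʳ-⊆ P {Q} {R} Q⊆R x∈P∪Q = [ p⊆p∪q R , (λ x∈Q → q⊆p∪q P R (Q⊆R x∈Q)) ]′ (x∈p∪q⁻ P Q x∈P∪Q)

drawn-take-suc : ∀ {n} m (s : List (Fin n)) → drawn (take m s) ⊆ drawn (take (suc m) s)
drawn-take-suc zero    s       = ⊆-min _
drawn-take-suc (suc m) []      = λ x∈⊥ → x∈⊥
drawn-take-suc (suc m) (x ∷ s) = ∪-monoʳ-⊆ ⁅ x ⁆ (drawn-take-suc m s)

drawn-take : ∀ {n} m (s : List (Fin n)) → drawn (take m s) ⊆ drawn s
drawn-take zero    s       = ⊆-min _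
drawn-take (suc m) []      = λ x∈⊥ → x∈⊥
drawn-take (suc m) (x ∷ s) = ∪-monoʳ-⊆ ⁅ x ⁆ (drawn-take m s)

module _ {n} (R : Subset n → Bool) (R-mono : ∀ {J K} → J ⊆ K → R J ≡ true → R K ≡ true) where

  hitBefore-suc : ∀ s m → hitBefore R s (suc m) ≡ R (drawn (take m s))
  hitBefore-suc s zero = refl
  hitBefore-suc s (suc m) rewrite hitBefore-suc s m with R (drawn (take m s)) in hit
  ... | true  = sym (R-mono (drawn-take-suc m s) hit)
  ... | false = refl

  𝟙-stopsAt : ∀ r s → 𝟙 (stopsAt R (suc r) s) ≡ 𝟙 (not (R (drawn (take r s)))) - 𝟙 (not (R (drawn s)))
  𝟙-stopsAt r s rewrite hitBefore-suc s r with R (drawn (take r s)) in hit | R (drawn s) in ret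
  ... | true  | true  = refl
  ... | true  | false with () ← trans (sym (R-mono (drawn-take r s) hit)) ret
  ... | false | true  = refl
  ... | false | false = refl

module _ {n v} (A : Fin v → Subset n) (R : Subset n → Bool)
         (R-covers : ∀ T → R T ≡ does (any? (λ j → A j ⊆? T))) where

  R-mono : ∀ {J K} → J ⊆ K → R J ≡ true → R K ≡ true
  R-mono {J} {K} J⊆K RJ with any? (λ j → A j ⊆? J) | R-covers J
  ... | yes (j , Aj⊆J) | _    = trans (R-covers K) (dec-true (any? (λ j → A j ⊆? K)) (j , ⊆-trans Aj⊆J J⊆K))
  ... | no _           | RJ≡false with () ← trans (sym RJ) RJ≡false

  unretrieved : ℕ → Subset n → ℚ
  unretrieved r T = ∑[ s ← allSeqs n r ] 𝟙 (not (R (T ∪ drawn s)))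

  unretrieved-suc : ∀ r T → unretrieved (suc r) T ≡ ∑[ x ← allFin n ] unretrieved r (T ∪ ⁅ x ⁆)
  unretrieved-suc r T = trans (∑-allSeqs-suc n r (λ s → 𝟙 (not (R (T ∪ drawn s)))))
    (∑-cong (λ x → ∑-cong (λ s → cong (λ U → 𝟙 (not (R U))) (sym (∪-assoc T ⁅ x ⁆ (drawn s)))) (allSeqs n r)) (allFin n))

  unretrieved-closed : ∀ r T → unretrieved r T ≡
    ∑[ S ← allSubsets v ] altSign S * (fromℕ n ^ r - fromℕ (missCount n (missing (⋃ A S) T) r))
  unretrieved-closed zero T
    rewrite ℚP.+-identityʳ (𝟙 (not (R (T ∪ ⊥)))) | ∪-identityʳ T | R-covers T =
    trans (inclusion-exclusion A T) (∑-cong (λ S → cong (altSign S *_) (𝟙-⊆-missCount n (⋃ A S) T)) (allSubsets v))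
  unretrieved-closed (suc r) T = begin
    unretrieved (suc r) T
      ≡⟨ unretrieved-suc r T ⟩
    ∑[ x ← allFin n ] unretrieved r (T ∪ ⁅ x ⁆)
      ≡⟨ ∑-cong (λ x → unretrieved-closed r (T ∪ ⁅ x ⁆)) (allFin n) ⟩
    ∑[ x ← allFin n ] ∑[ S ← allSubsets v ] altSign S * (fromℕ n ^ r - M S (T ∪ ⁅ x ⁆) r)
      ≡⟨ ∑-comm (λ x S → altSign S * (fromℕ n ^ r - M S (T ∪ ⁅ x ⁆) r)) (allFin n) (allSubsets v) ⟩
    ∑[ S ← allSubsets v ] ∑[ x ← allFin n ] altSign S * (fromℕ n ^ r - M S (T ∪ ⁅ x ⁆) r)
      ≡⟨ ∑-cong draw (allSubsets v) ⟩
    ∑[ S ← allSubsets v ] altSign S * (fromℕ n ^ suc r - M S T (suc r)) ∎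
    where
    open ≡-Reasoning
    M : Subset v → Subset n → ℕ → ℚ
    M S T r = fromℕ (missCount n (missing (⋃ A S) T) r)
    draw : ∀ S → ∑[ x ← allFin n ] altSign S * (fromℕ n ^ r - M S (T ∪ ⁅ x ⁆) r) ≡
                 altSign S * (fromℕ n ^ suc r - M S T (suc r))
    draw S = begin
      ∑[ x ← allFin n ] altSign S * (fromℕ n ^ r - M S (T ∪ ⁅ x ⁆) r)
        ≡⟨ ∑-*ˡ (altSign S) _ (allFin n) ⟩
      altSign S * (∑[ x ← allFin n ] (fromℕ n ^ r - M S (T ∪ ⁅ x ⁆) r))
        ≡⟨ cong (altSign S *_) (∑-- (λ _ → fromℕ n ^ r) _ (allFin n)) ⟩
      altSign S * ((∑[ x ← allFin n ] fromℕ n ^ r) - (∑[ x ← allFin n ] M S (T ∪ ⁅ x ⁆) r))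
        ≡⟨ cong₂ (λ a b → altSign S * (a - b)) (∑-allFin-const n (fromℕ n ^ r)) (missCount-after-draw n (⋃ A S) T r) ⟩
      altSign S * (fromℕ n ^ suc r - M S T (suc r)) ∎

  unretrieved-∅ : ∀ r → ∑[ s ← allSeqs n r ] 𝟙 (not (R (drawn s))) ≡
    ∑[ S ← allSubsets v ] altSign S * (fromℕ n ^ r - fromℕ (missCount n (# ⋃ A S) r))
  unretrieved-∅ r = begin
    ∑[ s ← allSeqs n r ] 𝟙 (not (R (drawn s)))
      ≡⟨ ∑-cong (λ s → cong (λ U → 𝟙 (not (R U))) (∪-identityˡ (drawn s))) (allSeqs n r) ⟨
    unretrieved r ⊥
      ≡⟨ unretrieved-closed r ⊥ ⟩
    ∑[ S ← allSubsets v ] altSign S * (fromℕ n ^ r - fromℕ (missCount n (missing (⋃ A S) ⊥) r))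
      ≡⟨ ∑-cong (λ S → cong (λ m → altSign S * (fromℕ n ^ r - fromℕ (missCount n m r))) (missing-⊥ (⋃ A S))) (allSubsets v) ⟩
    ∑[ S ← allSubsets v ] altSign S * (fromℕ n ^ r - fromℕ (missCount n (# ⋃ A S) r)) ∎
    where open ≡-Reasoning

  countStop-closed : ∀ r → fromℕ (countStop R (suc r)) ≡
    ∑[ S ← allSubsets v ] altSign S * (fromℕ (missCount n (# ⋃ A S) (suc r)) - fromℕ n * fromℕ (missCount n (# ⋃ A S) r))
  countStop-closed r = begin
    fromℕ (countStop R (suc r))
      ≡⟨ fromℕ-count (stopsAt R (suc r)) (allSeqs n (suc r)) ⟩
    ∑[ s ← allSeqs n (suc r) ] 𝟙 (stopsAt R (suc r) s)
      ≡⟨ ∑-cong (𝟙-stopsAt R R-mono r) (allSeqs n (suc r)) ⟩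
    ∑[ s ← allSeqs n (suc r) ] (𝟙 (not (R (drawn (take r s)))) - 𝟙 (not (R (drawn s))))
      ≡⟨ ∑-- _ _ (allSeqs n (suc r)) ⟩
    (∑[ s ← allSeqs n (suc r) ] 𝟙 (not (R (drawn (take r s))))) - (∑[ s ← allSeqs n (suc r) ] 𝟙 (not (R (drawn s))))
      ≡⟨ cong (_- (∑[ s ← allSeqs n (suc r) ] 𝟙 (not (R (drawn s))))) (∑-allSeqs-take n r (λ s → 𝟙 (not (R (drawn s))))) ⟩
    fromℕ n * (∑[ s ← allSeqs n r ] 𝟙 (not (R (drawn s)))) - (∑[ s ← allSeqs n (suc r) ] 𝟙 (not (R (drawn s))))
      ≡⟨ cong₂ (λ a b → fromℕ n * a - b) (unretrieved-∅ r) (unretrieved-∅ (suc r)) ⟩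
    fromℕ n * (∑[ S ← L ] altSign S * (fromℕ n ^ r - D S r)) - (∑[ S ← L ] altSign S * (fromℕ n ^ suc r - D S (suc r)))
      ≡⟨ cong (_- (∑[ S ← L ] altSign S * (fromℕ n ^ suc r - D S (suc r)))) (∑-*ˡ (fromℕ n) _ L) ⟨
    (∑[ S ← L ] fromℕ n * (altSign S * (fromℕ n ^ r - D S r))) - (∑[ S ← L ] altSign S * (fromℕ n ^ suc r - D S (suc r)))
      ≡⟨ ∑-- _ _ L ⟨
    ∑[ S ← L ] (fromℕ n * (altSign S * (fromℕ n ^ r - D S r)) - altSign S * (fromℕ n ^ suc r - D S (suc r)))
      ≡⟨ ∑-cong (λ S → solve 5 (λ N s p a b → N :* (s :* (p :- a)) :- s :* (N :* p :- b) := s :* (b :- N :* a)) refl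
                   (fromℕ n) (altSign S) (fromℕ n ^ r) (D S r) (D S (suc r))) L ⟩
    ∑[ S ← L ] altSign S * (D S (suc r) - fromℕ n * D S r) ∎
    where
    open ≡-Reasoning
    L = allSubsets v
    D : Subset v → ℕ → ℚ
    D S r = fromℕ (missCount n (# ⋃ A S) r)

-- The coupon collector

private
  cancel-inverses : ∀ N ν M μ t a b → N * ν ≡ 1ℚ → M * μ ≡ 1ℚ →
    (t - a) + N * μ * (ν * (M * a + (N - M) * b)) ≡ t + N * μ * b - b
  cancel-inverses N ν M μ t a b Nν≡1 Mμ≡1 = begin
    (t - a) + N * μ * (ν * (M * a + (N - M) * b))
      ≡⟨ solve 7 (λ N ν M μ t a b → (t :- a) :+ N :* μ :* (ν :* (M :* a :+ (N :- M) :* b))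
                  := t :- a :+ (N :* ν) :* (M :* μ) :* a :+ (N :* ν) :* (N :* μ :* b) :- (N :* ν) :* (M :* μ) :* b)
                 refl N ν M μ t a b ⟩
    t - a + (N * ν) * (M * μ) * a + (N * ν) * (N * μ * b) - (N * ν) * (M * μ) * b
      ≡⟨ cong₂ (λ x y → t - a + x * y * a + x * (N * μ * b) - x * y * b) Nν≡1 Mμ≡1 ⟩
    t - a + 1ℚ * 1ℚ * a + 1ℚ * (N * μ * b) - 1ℚ * 1ℚ * b
      ≡⟨ solve 4 (λ t a b c → t :- a :+ con 1ℚ :* con 1ℚ :* a :+ con 1ℚ :* c :- con 1ℚ :* con 1ℚ :* b
                  := t :+ c :- b) refl t a b (N * μ * b) ⟩
    t + N * μ * b - b ∎
    where open ≡-Reasoning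

module CouponCollector (n′ : ℕ) where

  n : ℕ
  n = suc n′

  missProb : ℕ → ℕ → ℚ
  missProb m r = fromℕ (missCount n m r) * recip n ^ r

  -- The tail Σ_{s ≥ r} missProb m s of the series n·H m = Σ_s missProb m s, in closed form.
  tail : ℕ → ℕ → ℚ
  tail zero    r = 0ℚ
  tail (suc m) r = tail m r + fromℕ n * recip (suc m) * missProb (suc m) r

  -- n·H m minus the m-coupon collector's expectation truncated after r draws.
  remainder : ℕ → ℕ → ℚ
  remainder m r = fromℕ r * missProb m r + tail m r

  missProb-suc : ∀ m r → suc m ≤ n → missProb (suc m) (suc r) ≡
    recip n * (fromℕ (suc m) * missProb m r + (fromℕ n - fromℕ (suc m)) * missProb (suc m) r)
  missProb-suc m r m<n = begin
    fromℕ (missCount n (suc m) (suc r)) * (recip n * ρ)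
      ≡⟨ cong (_* (recip n * ρ)) (fromℕ-missCount-suc n m r m<n) ⟩
    (fromℕ (suc m) * fromℕ a + (fromℕ n - fromℕ (suc m)) * fromℕ b) * (recip n * ρ)
      ≡⟨ solve 6 (λ M A N B ν ρ → (M :* A :+ (N :- M) :* B) :* (ν :* ρ) := ν :* (M :* (A :* ρ) :+ (N :- M) :* (B :* ρ)))
           refl (fromℕ (suc m)) (fromℕ a) (fromℕ n) (fromℕ b) (recip n) ρ ⟩
    recip n * (fromℕ (suc m) * missProb m r + (fromℕ n - fromℕ (suc m)) * missProb (suc m) r) ∎
    where
    open ≡-Reasoning
    a = missCount n m r
    b = missCount n (suc m) r
    ρ = recip n ^ r

  tail-zero : ∀ m → tail m 0 ≡ fromℕ n * H m
  tail-zero zero    = sym (ℚP.*-zeroʳ (fromℕ n))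
  tail-zero (suc m) rewrite tail-zero m =
    solve 3 (λ N h ρ → N :* h :+ N :* ρ :* ((con 1ℚ :+ con 0ℚ) :* con 1ℚ) := N :* (h :+ ρ)) refl
      (fromℕ n) (H m) (recip (suc m))

  tail-suc : ∀ m r → m ≤ n → tail m (suc r) ≡ tail m r - missProb m r
  tail-suc zero    r _   = solve 1 (λ ρ → con 0ℚ := con 0ℚ :- con 0ℚ :* ρ) refl (recip n ^ r)
  tail-suc (suc m) r m<n = begin
    tail m (suc r) + fromℕ n * recip (suc m) * missProb (suc m) (suc r)
      ≡⟨ cong₂ (λ t e → t + fromℕ n * recip (suc m) * e) (tail-suc m r (ℕP.<⇒≤ m<n)) (missProb-suc m r m<n) ⟩
    (tail m r - missProb m r) + fromℕ n * recip (suc m) *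
      (recip n * (fromℕ (suc m) * missProb m r + (fromℕ n - fromℕ (suc m)) * missProb (suc m) r))
      ≡⟨ cancel-inverses (fromℕ n) (recip n) (fromℕ (suc m)) (recip (suc m)) (tail m r) (missProb m r) (missProb (suc m) r)
           (fromℕ*recip n) (fromℕ*recip (suc m)) ⟩
    tail (suc m) r - missProb (suc m) r ∎
    where open ≡-Reasoning

  remainder-zero : ∀ m → remainder m 0 ≡ fromℕ n * H m
  remainder-zero m rewrite tail-zero m = solve 2 (λ e t → con 0ℚ :* e :+ t := t) refl (missProb m 0) (fromℕ n * H m)

  remainder-suc : ∀ m r → m ≤ n →
    remainder m (suc r) ≡ remainder m r + fromℕ (suc r) * (missProb m (suc r) - missProb m r)
  remainder-suc m r m≤n rewrite tail-suc m r m≤n =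
    solve 4 (λ k e′ e t → (con 1ℚ :+ k) :* e′ :+ (t :- e) := k :* e :+ t :+ (con 1ℚ :+ k) :* (e′ :- e)) refl
      (fromℕ r) (missProb m (suc r)) (missProb m r) (tail m r)

module _ {ℓ k n′} (enc : Encoder ℓ k (suc n′)) (i : Fin k) (dec : ∀ J → Dec (IsRetrieval enc i J))
         {v} (A : Fin v → Subset (suc n′))
         (R-covers : ∀ J → ⌊ dec J ⌋ ≡ does (any? (λ j → A j ⊆? J))) where

  open CouponCollector n′

  private
    R : Subset n → Bool
    R J = ⌊ dec J ⌋
    L = allSubsets v

  stopProb : ∀ r → probOf (countStop R (suc r)) n (suc r) ≡
    ∑[ S ← L ] altSign S * (missProb (# ⋃ A S) (suc r) - missProb (# ⋃ A S) r)
  stopProb r = begin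
    probOf (countStop R (suc r)) n (suc r)
      ≡⟨ probOf≡ (countStop R (suc r)) n (suc r) ⟩
    fromℕ (countStop R (suc r)) * recip n ^ suc r
      ≡⟨ cong (_* recip n ^ suc r) (countStop-closed A R R-covers r) ⟩
    (∑[ S ← L ] altSign S * (D S (suc r) - fromℕ n * D S r)) * recip n ^ suc r
      ≡⟨ ∑-*ʳ (recip n ^ suc r) _ L ⟨
    ∑[ S ← L ] altSign S * (D S (suc r) - fromℕ n * D S r) * recip n ^ suc r
      ≡⟨ ∑-cong per-subset L ⟩
    ∑[ S ← L ] altSign S * (missProb (# ⋃ A S) (suc r) - missProb (# ⋃ A S) r) ∎
    where
    open ≡-Reasoning
    D : Subset v → ℕ → ℚ
    D S r = fromℕ (missCount n (# ⋃ A S) r)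
    per-subset : ∀ S → altSign S * (D S (suc r) - fromℕ n * D S r) * recip n ^ suc r ≡
                       altSign S * (missProb (# ⋃ A S) (suc r) - missProb (# ⋃ A S) r)
    per-subset S = begin
      altSign S * (D S (suc r) - fromℕ n * D S r) * (recip n * recip n ^ r)
        ≡⟨ solve 6 (λ s d′ N d ν ρ → s :* (d′ :- N :* d) :* (ν :* ρ) := s :* (d′ :* (ν :* ρ) :- (N :* ν) :* (d :* ρ))) refl
             (altSign S) (D S (suc r)) (fromℕ n) (D S r) (recip n) (recip n ^ r) ⟩
      altSign S * (D S (suc r) * (recip n * recip n ^ r) - (fromℕ n * recip n) * (D S r * recip n ^ r))
        ≡⟨ cong (λ x → altSign S * (D S (suc r) * (recip n * recip n ^ r) - x * (D S r * recip n ^ r))) (fromℕ*recip n) ⟩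
      altSign S * (D S (suc r) * (recip n * recip n ^ r) - 1ℚ * (D S r * recip n ^ r))
        ≡⟨ cong (λ x → altSign S * (D S (suc r) * (recip n * recip n ^ r) - x)) (ℚP.*-identityˡ _) ⟩
      altSign S * (missProb (# ⋃ A S) (suc r) - missProb (# ⋃ A S) r) ∎

  partialExpectation-closed : ∀ K → partialExpectation enc i dec (suc K) ≡
    ∑[ S ← L ] altSign S * (remainder (# ⋃ A S) K - fromℕ n * H (# ⋃ A S))
  partialExpectation-closed zero = sym (begin
    ∑[ S ← L ] altSign S * (remainder (# ⋃ A S) 0 - fromℕ n * H (# ⋃ A S))
      ≡⟨ ∑-cong (λ S → cong (λ x → altSign S * (x - fromℕ n * H (# ⋃ A S))) (remainder-zero (# ⋃ A S))) L ⟩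
    ∑[ S ← L ] altSign S * (fromℕ n * H (# ⋃ A S) - fromℕ n * H (# ⋃ A S))
      ≡⟨ ∑-cong (λ S → solve 2 (λ s x → s :* (x :- x) := con 0ℚ) refl (altSign S) (fromℕ n * H (# ⋃ A S))) L ⟩
    ∑[ S ← L ] 0ℚ
      ≡⟨ ∑-0 L ⟩
    0ℚ
      ≡⟨ solve 1 (λ p → con 0ℚ := con 0ℚ :+ con 0ℚ :* p) refl (probOf (countStop R 0) n 0) ⟩
    partialExpectation enc i dec 1 ∎)
    where open ≡-Reasoning
  partialExpectation-closed (suc K) = begin
    partialExpectation enc i dec (suc K) + (ℤ.+ suc K ℚ./ 1) * probOf (countStop R (suc K)) n (suc K)
      ≡⟨ cong₂ (λ x y → x + y * probOf (countStop R (suc K)) n (suc K))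
               (partialExpectation-closed K) (sym (fromℕ≡/1 (suc K))) ⟩
    (∑[ S ← L ] altSign S * (rem S K - N * h S)) + fromℕ (suc K) * probOf (countStop R (suc K)) n (suc K)
      ≡⟨ cong (λ x → (∑[ S ← L ] altSign S * (rem S K - N * h S)) + fromℕ (suc K) * x) (stopProb K) ⟩
    (∑[ S ← L ] altSign S * (rem S K - N * h S)) + fromℕ (suc K) * (∑[ S ← L ] altSign S * (e S (suc K) - e S K))
      ≡⟨ cong ((∑[ S ← L ] altSign S * (rem S K - N * h S)) +_) (∑-*ˡ (fromℕ (suc K)) _ L) ⟨
    (∑[ S ← L ] altSign S * (rem S K - N * h S)) + (∑[ S ← L ] fromℕ (suc K) * (altSign S * (e S (suc K) - e S K)))
      ≡⟨ ∑-+ _ _ L ⟨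
    ∑[ S ← L ] (altSign S * (rem S K - N * h S) + fromℕ (suc K) * (altSign S * (e S (suc K) - e S K)))
      ≡⟨ ∑-cong step L ⟩
    ∑[ S ← L ] altSign S * (rem S (suc K) - N * h S) ∎
    where
    open ≡-Reasoning
    N = fromℕ n
    h : Subset v → ℚ
    h S = H (# ⋃ A S)
    e rem : Subset v → ℕ → ℚ
    e S = missProb (# ⋃ A S)
    rem S = remainder (# ⋃ A S)
    step : ∀ S → altSign S * (rem S K - N * h S) + fromℕ (suc K) * (altSign S * (e S (suc K) - e S K)) ≡
                 altSign S * (rem S (suc K) - N * h S)
    step S rewrite remainder-suc (# ⋃ A S) K (∣p∣≤n (⋃ A S)) =
      solve 6 (λ s x y k e′ e → s :* (x :- y) :+ k :* (s :* (e′ :- e)) := s :* ((x :+ k :* (e′ :- e)) :- y)) refl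
        (altSign S) (rem S K) (N * h S) (fromℕ (suc K)) (e S (suc K)) (e S K)

∑-upTo-snoc : ∀ (f : ℕ → ℚ) v → ∑ (upTo (suc v)) f ≡ ∑ (upTo v) f + f v
∑-upTo-snoc f v = begin
  ∑ (upTo (suc v)) f          ≡⟨ cong (λ xs → ∑ xs f) (LP.applyUpTo-∷ʳ (λ x → x) v) ⟨
  ∑ (upTo v ∷ʳ v) f           ≡⟨ ∑-++ f (upTo v) (v ∷ []) ⟩
  ∑ (upTo v) f + (f v + 0ℚ)   ≡⟨ cong (∑ (upTo v) f +_) (ℚP.+-identityʳ (f v)) ⟩
  ∑ (upTo v) f + f v          ∎
  where open ≡-Reasoning

module _ (f : ℕ → ℚ) (x : ℚ) (c : ℕ) where

  private
    δ : ℕ → ℚ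
    δ s = f s * (if does (c ℕ.≟ s) then x else 0ℚ)

    δ-≢ : ∀ {s} → c ≢ s → δ s ≡ 0ℚ
    δ-≢ {s} c≢s rewrite dec-false (c ℕ.≟ s) c≢s = ℚP.*-zeroʳ (f s)

    δ-≡ : δ c ≡ f c * x
    δ-≡ rewrite dec-true (c ℕ.≟ c) refl = refl

  ∑-upTo-≟-absent : ∀ v → v ≤ c → ∑[ s ← upTo v ] f s * (if does (c ℕ.≟ s) then x else 0ℚ) ≡ 0ℚ
  ∑-upTo-≟-absent zero    _   = refl
  ∑-upTo-≟-absent (suc v) v<c = begin
    ∑ (upTo (suc v)) δ ≡⟨ ∑-upTo-snoc δ v ⟩
    ∑ (upTo v) δ + δ v ≡⟨ cong₂ _+_ (∑-upTo-≟-absent v (ℕP.<⇒≤ v<c)) (δ-≢ (ℕP.>⇒≢ v<c)) ⟩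
    0ℚ + 0ℚ            ≡⟨⟩
    0ℚ                 ∎
    where open ≡-Reasoning

  ∑-upTo-≟ : ∀ v → c ℕ.< v → ∑[ s ← upTo v ] f s * (if does (c ℕ.≟ s) then x else 0ℚ) ≡ f c * x
  ∑-upTo-≟ (suc v) c<1+v = trans (∑-upTo-snoc δ v) (last (ℕP.m≤n⇒m<n∨m≡n (ℕP.≤-pred c<1+v)))
    where
    last : c ℕ.< v ⊎ c ≡ v → ∑ (upTo v) δ + δ v ≡ f c * x
    last (inj₁ c<v)  = trans (cong₂ _+_ (∑-upTo-≟ v c<v) (δ-≢ (ℕP.<⇒≢ c<v))) (ℚP.+-identityʳ (f c * x))
    last (inj₂ refl) = trans (cong₂ _+_ (∑-upTo-≟-absent v ℕP.≤-refl) δ-≡) (ℚP.+-identityˡ (f c * x))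

∑-by-size : ∀ v (h : Subset v → ℚ) → (∀ S → # S ≡ 0 → h S ≡ 0ℚ) →
  sumℚ (List.map (λ s → signOf s * sumℚ (List.map h (filter (λ S → # S ℕ.≟ s) (allSubsets v)))) (List.map suc (upTo v)))
  ≡ ∑[ S ← allSubsets v ] signOf (# S) * h S
∑-by-size v h h∅≡0 = begin
  sumℚ (List.map F (List.map suc (upTo v)))
    ≡⟨ sumℚ-map F (List.map suc (upTo v)) ⟩
  ∑ (List.map suc (upTo v)) F
    ≡⟨ ∑-map F suc (upTo v) ⟩
  ∑[ t ← upTo v ] F (suc t)
    ≡⟨ ∑-cong expand (upTo v) ⟩
  ∑[ t ← upTo v ] ∑[ S ← L ] signOf (suc t) * (if does (# S ℕ.≟ suc t) then h S else 0ℚ)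
    ≡⟨ ∑-comm (λ t S → signOf (suc t) * (if does (# S ℕ.≟ suc t) then h S else 0ℚ)) (upTo v) L ⟩
  ∑[ S ← L ] ∑[ t ← upTo v ] signOf (suc t) * (if does (# S ℕ.≟ suc t) then h S else 0ℚ)
    ≡⟨ ∑-cong pick L ⟩
  ∑[ S ← L ] signOf (# S) * h S ∎
  where
  open ≡-Reasoning
  L = allSubsets v
  F : ℕ → ℚ
  F s = signOf s * sumℚ (List.map h (filter (λ S → # S ℕ.≟ s) L))
  expand : ∀ t → F (suc t) ≡ ∑[ S ← L ] signOf (suc t) * (if does (# S ℕ.≟ suc t) then h S else 0ℚ)
  expand t = trans (cong (signOf (suc t) *_) (trans (sumℚ-map h (filter (λ S → # S ℕ.≟ suc t) L)) (∑-filter (λ S → # S ℕ.≟ suc t) h L)))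
                   (sym (∑-*ˡ (signOf (suc t)) _ L))
  pick : ∀ S → ∑[ t ← upTo v ] signOf (suc t) * (if does (# S ℕ.≟ suc t) then h S else 0ℚ) ≡ signOf (# S) * h S
  pick S with # S in #S≡ | ∣p∣≤n S
  ... | zero  | _     = trans (∑-cong (λ t → ℚP.*-zeroʳ (signOf (suc t))) (upTo v))
                             (trans (∑-0 (upTo v)) (sym (trans (cong (signOf 0 *_) (h∅≡0 S #S≡)) (ℚP.*-zeroʳ (signOf 0)))))
  ... | suc c | c<v   = ∑-upTo-≟ (λ t → signOf (suc t)) (h S) c v c<v

#[p∪q]≡#p+#q : ∀ {n} (P Q : Subset n) → P ∩ Q ≡ ⊥ → # (P ∪ Q) ≡ # P ℕ.+ # Q
#[p∪q]≡#p+#q []          []          _   = refl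
#[p∪q]≡#p+#q (true ∷ P)  (true ∷ Q)  P∩Q≡⊥ with () ← proj₁ (VP.∷-injective P∩Q≡⊥)
#[p∪q]≡#p+#q (true ∷ P)  (false ∷ Q) P∩Q≡⊥ = cong suc (#[p∪q]≡#p+#q P Q (proj₂ (VP.∷-injective P∩Q≡⊥)))
#[p∪q]≡#p+#q (false ∷ P) (true ∷ Q)  P∩Q≡⊥ =
  trans (cong suc (#[p∪q]≡#p+#q P Q (proj₂ (VP.∷-injective P∩Q≡⊥)))) (sym (ℕP.+-suc (# P) (# Q)))
#[p∪q]≡#p+#q (false ∷ P) (false ∷ Q) P∩Q≡⊥ = #[p∪q]≡#p+#q P Q (proj₂ (VP.∷-injective P∩Q≡⊥))

∩-⋃≡⊥ : ∀ {v n} (A : Fin v → Subset n) B → (∀ j → B ∩ A j ≡ ⊥) → ∀ S → B ∩ ⋃ A S ≡ ⊥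
∩-⋃≡⊥ {zero}  A B _       []          = ∩-zeroʳ B
∩-⋃≡⊥ {suc v} A B B∩A≡⊥ (true ∷ S)  = begin
  B ∩ (A fzero ∪ ⋃ A′ S)        ≡⟨ ∩-distribˡ-∪ B (A fzero) (⋃ A′ S) ⟩
  (B ∩ A fzero) ∪ (B ∩ ⋃ A′ S)  ≡⟨ cong₂ _∪_ (B∩A≡⊥ fzero) (∩-⋃≡⊥ A′ B (λ j → B∩A≡⊥ (fsuc j)) S) ⟩
  ⊥ ∪ ⊥                         ≡⟨ ∪-identityˡ ⊥ ⟩
  ⊥                             ∎
  where open ≡-Reasoning
        A′ = λ j → A (fsuc j)
∩-⋃≡⊥ {suc v} A B B∩A≡⊥ (false ∷ S) = ∩-⋃≡⊥ (λ j → A (fsuc j)) B (λ j → B∩A≡⊥ (fsuc j)) S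

#⋃≡sizeSum : ∀ {v n} (A : Fin v → Subset n) → (∀ j j′ → j ≢ j′ → A j ∩ A j′ ≡ ⊥) →
              ∀ S → # ⋃ A S ≡ sizeSum A S
#⋃≡sizeSum {zero} {n} A _        []          = ∣⊥∣≡0 n
#⋃≡sizeSum {suc v}    A disjoint (true ∷ S)  =
  trans (#[p∪q]≡#p+#q (A fzero) _ (∩-⋃≡⊥ A′ (A fzero) (λ j → disjoint fzero (fsuc j) λ ()) S))
        (cong (# A fzero ℕ.+_) (#⋃≡sizeSum A′ (λ j j′ j≢j′ → disjoint (fsuc j) (fsuc j′) (j≢j′ ∘ suc-injective)) S))
  where A′ = λ j → A (fsuc j)
#⋃≡sizeSum {suc v}    A disjoint (false ∷ S) =
  #⋃≡sizeSum (λ j → A (fsuc j)) (λ j j′ j≢j′ → disjoint (fsuc j) (fsuc j′) (j≢j′ ∘ suc-injective)) S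

#⋃∅≡0 : ∀ {v n} (A : Fin v → Subset n) S → # S ≡ 0 → # ⋃ A S ≡ 0
#⋃∅≡0 {zero} {n} A []          _    = ∣⊥∣≡0 n
#⋃∅≡0 {suc v}    A (false ∷ S) #S≡0 = #⋃∅≡0 (λ j → A (fsuc j)) S #S≡0

signOf-# : ∀ {v} (S : Subset v) → signOf (# S) ≡ - altSign S
signOf-# []          = refl
signOf-# (true ∷ S)  = cong -_ (signOf-# S)
signOf-# (false ∷ S) = signOf-# S

formula-closed : ∀ n v (A : Fin v → Subset n) → (∀ j j′ → j ≢ j′ → A j ∩ A j′ ≡ ⊥) →
  formula n v A ≡ fromℕ n * (∑[ S ← allSubsets v ] (- altSign S) * H (# ⋃ A S))
formula-closed n v A disjoint = cong₂ _*_ (sym (fromℕ≡/1 n))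
  (trans (∑-by-size v (λ S → H (sizeSum A S)) (λ S #S≡0 → cong H (trans (sym (size≡ S)) (#⋃∅≡0 A S #S≡0))))
         (∑-cong (λ S → cong₂ _*_ (signOf-# S) (cong H (sym (size≡ S)))) (allSubsets v)))
  where size≡ = #⋃≡sizeSum A disjoint

-- Estimates

0≤fromℕ : ∀ k → 0ℚ ≤ℚ fromℕ k
0≤fromℕ k = subst (0ℚ ≤ℚ_) (sym (fromℕ≡/1 k)) (ℚP.nonNegative⁻¹ _ {{ℚP.normalize-nonNeg k 1}})

fromℕ-mono-≤ : ∀ {a b} → a ≤ b → fromℕ a ≤ℚ fromℕ b
fromℕ-mono-≤ {a} {b} a≤b = begin
  fromℕ a                     ≡⟨ ℚP.+-identityʳ (fromℕ a) ⟨
  fromℕ a + 0ℚ                ≤⟨ ℚP.+-monoʳ-≤ (fromℕ a) (0≤fromℕ (b ℕ.∸ a)) ⟩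
  fromℕ a + fromℕ (b ℕ.∸ a)   ≡⟨ fromℕ-+ a (b ℕ.∸ a) ⟨
  fromℕ (a ℕ.+ (b ℕ.∸ a))     ≡⟨ cong fromℕ (ℕP.m+[n∸m]≡n a≤b) ⟩
  fromℕ b                     ∎
  where open ℚP.≤-Reasoning

*-monoˡ-≤-0≤ : ∀ {r p q} → 0ℚ ≤ℚ r → p ≤ℚ q → r * p ≤ℚ r * q
*-monoˡ-≤-0≤ {r} 0≤r = ℚP.*-monoˡ-≤-nonNeg r {{ℚ.nonNegative 0≤r}}

*-monoʳ-≤-0≤ : ∀ {r p q} → 0ℚ ≤ℚ r → p ≤ℚ q → p * r ≤ℚ q * r
*-monoʳ-≤-0≤ {r} 0≤r = ℚP.*-monoʳ-≤-nonNeg r {{ℚ.nonNegative 0≤r}}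

0≤* : ∀ {p q} → 0ℚ ≤ℚ p → 0ℚ ≤ℚ q → 0ℚ ≤ℚ p * q
0≤* {p} 0≤p 0≤q = subst (_≤ℚ p * _) (ℚP.*-zeroʳ p) (*-monoˡ-≤-0≤ 0≤p 0≤q)

0≤recip : ∀ d .{{_ : ℕ.NonZero d}} → 0ℚ ≤ℚ recip d
0≤recip (suc d) = ℚP.nonNegative⁻¹ _ {{ℚP.normalize-nonNeg 1 (suc d)}}

0≤^ : ∀ {x} r → 0ℚ ≤ℚ x → 0ℚ ≤ℚ x ^ r
0≤^ zero    _   = ℚP.nonNegative⁻¹ 1ℚ
0≤^ (suc r) 0≤x = 0≤* 0≤x (0≤^ r 0≤x)

missCount-≤ : ∀ n′ m r → m ≤ suc n′ → missCount (suc n′) m r ≤ m ℕ.* n′ ℕ.^ r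
missCount-≤ n′ zero    r       _         = z≤n
missCount-≤ n′ (suc m) zero    _         = s≤s z≤n
missCount-≤ n′ (suc m) (suc r) (s≤s m≤n′) = begin
  suc m ℕ.* missCount (suc n′) m r ℕ.+ (n′ ℕ.∸ m) ℕ.* missCount (suc n′) (suc m) r
    ≤⟨ ℕP.+-mono-≤ (ℕP.*-monoʳ-≤ (suc m) (missCount-≤ n′ m r (ℕP.m≤n⇒m≤1+n m≤n′)))
                   (ℕP.*-monoʳ-≤ (n′ ℕ.∸ m) (missCount-≤ n′ (suc m) r (s≤s m≤n′))) ⟩
  suc m ℕ.* (m ℕ.* P) ℕ.+ (n′ ℕ.∸ m) ℕ.* (suc m ℕ.* P)
    ≡⟨ regroup m (n′ ℕ.∸ m) P ⟩
  suc m ℕ.* ((m ℕ.+ (n′ ℕ.∸ m)) ℕ.* P)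
    ≡⟨ cong (λ z → suc m ℕ.* (z ℕ.* P)) (ℕP.m+[n∸m]≡n m≤n′) ⟩
  suc m ℕ.* (n′ ℕ.* P) ∎
  where
  open ℕP.≤-Reasoning
  P = n′ ℕ.^ r
  regroup : ∀ m t P → suc m ℕ.* (m ℕ.* P) ℕ.+ t ℕ.* (suc m ℕ.* P) ≡ suc m ℕ.* ((m ℕ.+ t) ℕ.* P)
  regroup = solve-∀

[1+K]*a^K≤[1+a]^[1+K] : ∀ a K → suc K ℕ.* a ℕ.^ K ≤ suc a ℕ.^ suc K
[1+K]*a^K≤[1+a]^[1+K] a zero    = s≤s z≤n
[1+K]*a^K≤[1+a]^[1+K] a (suc K) = begin
  suc (suc K) ℕ.* (a ℕ.* a ℕ.^ K)                   ≡⟨ split K a (a ℕ.^ K) ⟩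
  a ℕ.* (suc K ℕ.* a ℕ.^ K) ℕ.+ a ℕ.^ suc K         ≤⟨ ℕP.+-mono-≤ (ℕP.*-monoʳ-≤ a ([1+K]*a^K≤[1+a]^[1+K] a K))
                                                                   (ℕP.^-monoˡ-≤ (suc K) (ℕP.n≤1+n a)) ⟩
  a ℕ.* suc a ℕ.^ suc K ℕ.+ suc a ℕ.^ suc K         ≡⟨ merge a (suc a ℕ.^ suc K) ⟩
  suc a ℕ.^ suc (suc K)                             ∎
  where
  open ℕP.≤-Reasoning
  split : ∀ K a P → (2 ℕ.+ K) ℕ.* (a ℕ.* P) ≡ a ℕ.* ((1 ℕ.+ K) ℕ.* P) ℕ.+ a ℕ.* P
  split = solve-∀
  merge : ∀ a Q → a ℕ.* Q ℕ.+ Q ≡ (1 ℕ.+ a) ℕ.* Q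
  merge = solve-∀

[1+K][2+K]*a^K≤2*[1+a]^[2+K] : ∀ a K → suc K ℕ.* suc (suc K) ℕ.* a ℕ.^ K ≤ 2 ℕ.* suc a ℕ.^ suc (suc K)
[1+K][2+K]*a^K≤2*[1+a]^[2+K] a zero    = ℕP.*-monoʳ-≤ 2 (ℕP.^-monoˡ-≤ 2 (s≤s (z≤n {a})))
[1+K][2+K]*a^K≤2*[1+a]^[2+K] a (suc K) = begin
  suc (suc K) ℕ.* suc (suc (suc K)) ℕ.* (a ℕ.* a ℕ.^ K)
    ≡⟨ split K a (a ℕ.^ K) ⟩
  a ℕ.* (suc K ℕ.* suc (suc K) ℕ.* a ℕ.^ K) ℕ.+ 2 ℕ.* (suc (suc K) ℕ.* a ℕ.^ suc K)
    ≤⟨ ℕP.+-mono-≤ (ℕP.*-monoʳ-≤ a ([1+K][2+K]*a^K≤2*[1+a]^[2+K] a K)) (ℕP.*-monoʳ-≤ 2 ([1+K]*a^K≤[1+a]^[1+K] a (suc K))) ⟩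
  a ℕ.* (2 ℕ.* suc a ℕ.^ suc (suc K)) ℕ.+ 2 ℕ.* suc a ℕ.^ suc (suc K)
    ≡⟨ merge a (suc a ℕ.^ suc (suc K)) ⟩
  2 ℕ.* suc a ℕ.^ suc (suc (suc K)) ∎
  where
  open ℕP.≤-Reasoning
  split : ∀ K a P → (2 ℕ.+ K) ℕ.* (3 ℕ.+ K) ℕ.* (a ℕ.* P) ≡
                    a ℕ.* ((1 ℕ.+ K) ℕ.* (2 ℕ.+ K) ℕ.* P) ℕ.+ 2 ℕ.* ((2 ℕ.+ K) ℕ.* (a ℕ.* P))
  split = solve-∀
  merge : ∀ a Q → a ℕ.* (2 ℕ.* Q) ℕ.+ 2 ℕ.* Q ≡ 2 ℕ.* ((1 ℕ.+ a) ℕ.* Q)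
  merge = solve-∀

C*[K+n]*a^K≤n^K : ∀ a C K → let n = suc a in 2 ℕ.* C ℕ.* n ℕ.^ 3 ≤ suc K → C ℕ.* ((K ℕ.+ n) ℕ.* a ℕ.^ K) ≤ n ℕ.^ K
C*[K+n]*a^K≤n^K a C K 2Cn³≤1+K = ℕP.*-cancelˡ-≤ (suc K) (begin
  suc K ℕ.* (C ℕ.* ((K ℕ.+ n) ℕ.* a ℕ.^ K))      ≡⟨ swap K C n (a ℕ.^ K) ⟩
  C ℕ.* (K ℕ.+ n) ℕ.* (suc K ℕ.* a ℕ.^ K)        ≤⟨ ℕP.*-monoˡ-≤ (suc K ℕ.* a ℕ.^ K) (ℕP.*-monoʳ-≤ C K+n≤n[2+K]) ⟩
  C ℕ.* (n ℕ.* suc (suc K)) ℕ.* (suc K ℕ.* a ℕ.^ K) ≡⟨ regroup K C n (a ℕ.^ K) ⟩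
  C ℕ.* n ℕ.* (suc K ℕ.* suc (suc K) ℕ.* a ℕ.^ K) ≤⟨ ℕP.*-monoʳ-≤ (C ℕ.* n) ([1+K][2+K]*a^K≤2*[1+a]^[2+K] a K) ⟩
  C ℕ.* n ℕ.* (2 ℕ.* n ℕ.^ suc (suc K))          ≡⟨ powers C n (n ℕ.^ K) ⟩
  2 ℕ.* C ℕ.* n ℕ.^ 3 ℕ.* n ℕ.^ K                ≤⟨ ℕP.*-monoˡ-≤ (n ℕ.^ K) 2Cn³≤1+K ⟩
  suc K ℕ.* n ℕ.^ K                              ∎)
  where
  open ℕP.≤-Reasoning
  n = suc a
  K+n≤n[2+K] : K ℕ.+ n ≤ n ℕ.* suc (suc K)
  K+n≤n[2+K] = begin
    K ℕ.+ n               ≤⟨ ℕP.+-mono-≤ (ℕP.m≤m*n K n) (ℕP.m≤m*n n 2) ⟩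
    K ℕ.* n ℕ.+ n ℕ.* 2   ≡⟨ comm K n ⟩
    n ℕ.* suc (suc K)     ∎
    where comm : ∀ K n → K ℕ.* n ℕ.+ n ℕ.* 2 ≡ n ℕ.* (2 ℕ.+ K)
          comm = solve-∀
  swap : ∀ K C n P → (1 ℕ.+ K) ℕ.* (C ℕ.* ((K ℕ.+ n) ℕ.* P)) ≡ C ℕ.* (K ℕ.+ n) ℕ.* ((1 ℕ.+ K) ℕ.* P)
  swap = solve-∀
  regroup : ∀ K C n P → C ℕ.* (n ℕ.* (2 ℕ.+ K)) ℕ.* ((1 ℕ.+ K) ℕ.* P) ≡ C ℕ.* n ℕ.* ((1 ℕ.+ K) ℕ.* (2 ℕ.+ K) ℕ.* P)
  regroup = solve-∀
  powers : ∀ C n Q → C ℕ.* n ℕ.* (2 ℕ.* (n ℕ.* (n ℕ.* Q))) ≡ 2 ℕ.* C ℕ.* (n ℕ.* (n ℕ.* (n ℕ.* 1))) ℕ.* Q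
  powers = solve-∀

module Bounds (n′ : ℕ) where

  open CouponCollector n′

  avoidProb : ℕ → ℚ
  avoidProb K = fromℕ (n′ ℕ.^ K) * recip n ^ K

  private
    ν = recip n
    P : ℕ → ℕ
    P K = n′ ℕ.^ K

  0≤avoidProb : ∀ K → 0ℚ ≤ℚ avoidProb K
  0≤avoidProb K = 0≤* (0≤fromℕ (P K)) (0≤^ K (0≤recip n))

  0≤missProb : ∀ m K → 0ℚ ≤ℚ missProb m K
  0≤missProb m K = 0≤* (0≤fromℕ (missCount n m K)) (0≤^ K (0≤recip n))

  missProb≤ : ∀ m K → m ≤ n → missProb m K ≤ℚ fromℕ m * avoidProb K
  missProb≤ m K m≤n = begin
    fromℕ (missCount n m K) * ν ^ K     ≤⟨ *-monoʳ-≤-0≤ (0≤^ K (0≤recip n)) (fromℕ-mono-≤ (missCount-≤ n′ m K m≤n)) ⟩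
    fromℕ (m ℕ.* P K) * ν ^ K           ≡⟨ cong (_* ν ^ K) (fromℕ-* m (P K)) ⟩
    fromℕ m * fromℕ (P K) * ν ^ K       ≡⟨ ℚP.*-assoc (fromℕ m) (fromℕ (P K)) (ν ^ K) ⟩
    fromℕ m * (fromℕ (P K) * ν ^ K)     ∎
    where open ℚP.≤-Reasoning

  0≤tail : ∀ m K → 0ℚ ≤ℚ tail m K
  0≤tail zero    K = ℚP.≤-refl
  0≤tail (suc m) K = ℚP.+-mono-≤ (0≤tail m K) (0≤* (0≤* (0≤fromℕ n) (0≤recip (suc m))) (0≤missProb (suc m) K))

  tail≤ : ∀ m K → m ≤ n → tail m K ≤ℚ fromℕ m * (fromℕ n * avoidProb K)
  tail≤ zero    K _   = ℚP.≤-reflexive (sym (ℚP.*-zeroˡ (fromℕ n * avoidProb K)))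
  tail≤ (suc m) K m<n = begin
    tail m K + fromℕ n * recip (suc m) * missProb (suc m) K
      ≤⟨ ℚP.+-mono-≤ (tail≤ m K (ℕP.<⇒≤ m<n)) (*-monoˡ-≤-0≤ (0≤* (0≤fromℕ n) (0≤recip (suc m))) (missProb≤ (suc m) K m<n)) ⟩
    fromℕ m * (fromℕ n * avoidProb K) + fromℕ n * recip (suc m) * (fromℕ (suc m) * avoidProb K)
      ≡⟨ solve 5 (λ M N x ρ M′ → M :* (N :* x) :+ N :* ρ :* (M′ :* x) := M :* (N :* x) :+ (M′ :* ρ) :* (N :* x)) refl
           (fromℕ m) (fromℕ n) (avoidProb K) (recip (suc m)) (fromℕ (suc m)) ⟩
    fromℕ m * (fromℕ n * avoidProb K) + (fromℕ (suc m) * recip (suc m)) * (fromℕ n * avoidProb K)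
      ≡⟨ cong (λ z → fromℕ m * (fromℕ n * avoidProb K) + z * (fromℕ n * avoidProb K)) (fromℕ*recip (suc m)) ⟩
    fromℕ m * (fromℕ n * avoidProb K) + 1ℚ * (fromℕ n * avoidProb K)
      ≡⟨ solve 2 (λ M y → M :* y :+ con 1ℚ :* y := (con 1ℚ :+ M) :* y) refl (fromℕ m) (fromℕ n * avoidProb K) ⟩
    fromℕ (suc m) * (fromℕ n * avoidProb K) ∎
    where open ℚP.≤-Reasoning

  0≤remainder : ∀ m K → 0ℚ ≤ℚ remainder m K
  0≤remainder m K = ℚP.+-mono-≤ (0≤* (0≤fromℕ K) (0≤missProb m K)) (0≤tail m K)

  remainder≤ : ∀ m K → m ≤ n → remainder m K ≤ℚ fromℕ n * ((fromℕ K + fromℕ n) * avoidProb K)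
  remainder≤ m K m≤n = begin
    fromℕ K * missProb m K + tail m K
      ≤⟨ ℚP.+-mono-≤ (*-monoˡ-≤-0≤ (0≤fromℕ K) (missProb≤ m K m≤n)) (tail≤ m K m≤n) ⟩
    fromℕ K * (fromℕ m * avoidProb K) + fromℕ m * (fromℕ n * avoidProb K)
      ≡⟨ solve 4 (λ k M x N → k :* (M :* x) :+ M :* (N :* x) := M :* ((k :+ N) :* x)) refl (fromℕ K) (fromℕ m) (avoidProb K) (fromℕ n) ⟩
    fromℕ m * ((fromℕ K + fromℕ n) * avoidProb K)
      ≤⟨ *-monoʳ-≤-0≤ (0≤* (ℚP.+-mono-≤ (0≤fromℕ K) (0≤fromℕ n)) (0≤avoidProb K)) (fromℕ-mono-≤ m≤n) ⟩
    fromℕ n * ((fromℕ K + fromℕ n) * avoidProb K) ∎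
    where open ℚP.≤-Reasoning

/≤ : ∀ ε → 0ℚ ℚ.< ε → ∀ c d .{{_ : ℕ.NonZero d}} → c ℕ.* ℚ.↧ₙ ε ≤ d → ℤ.+ c ℚ./ d ≤ℚ ε
/≤ (ℚ.mkℚ (ℤ.+ zero)   _ _) (ℚ.*<* (ℤ.+<+ ())) _ _ _
/≤ (ℚ.mkℚ ℤ.-[1+ _ ]  _ _) (ℚ.*<* ())         _ _ _
/≤ (ℚ.mkℚ (ℤ.+ suc p) q-1 _) _ c (suc d) c*q≤d = ℚP.toℚᵘ-cancel-≤
  (ℚᵘP.≤-respˡ-≃ (ℚᵘP.≃-sym (ℚP.toℚᵘ-fromℚᵘ (ℚᵘ.mkℚᵘ (ℤ.+ c) d))) (ℚᵘ.*≤* c*q≤[1+p]*d))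
  where
  c*q≤[1+p]*d : ℤ.+ c ℤ.* ℤ.+ suc q-1 ℤ.≤ ℤ.+ suc p ℤ.* ℤ.+ suc d
  c*q≤[1+p]*d = subst₂ ℤ._≤_ (ℤP.pos-* c (suc q-1)) (ℤP.pos-* (suc p) (suc d))
                  (ℤ.+≤+ (ℕP.≤-trans c*q≤d (ℕP.m≤n*m (suc d) (suc p))))

∣∑±∣≤∑ : ∀ {X : Set} (s w : X → ℚ) → (∀ x → ∣ s x ∣ ≡ 1ℚ) → (∀ x → 0ℚ ≤ℚ w x) → ∀ xs →
  ∣ ∑[ x ← xs ] s x * w x ∣ ≤ℚ ∑ xs w
∣∑±∣≤∑ s w ∣s∣≡1 0≤w []       = ℚP.≤-refl
∣∑±∣≤∑ s w ∣s∣≡1 0≤w (x ∷ xs) = ℚP.≤-trans (ℚP.∣p+q∣≤∣p∣+∣q∣ (s x * w x) _)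
  (ℚP.+-mono-≤ (ℚP.≤-reflexive ∣sw∣≡w) (∣∑±∣≤∑ s w ∣s∣≡1 0≤w xs))
  where
  ∣sw∣≡w : ∣ s x * w x ∣ ≡ w x
  ∣sw∣≡w = trans (ℚP.∣p*q∣≡∣p∣*∣q∣ (s x) (w x))
             (trans (cong₂ _*_ (∣s∣≡1 x) (ℚP.0≤p⇒∣p∣≡p (0≤w x))) (ℚP.*-identityˡ (w x)))

∑≤length* : ∀ {X : Set} (w : X → ℚ) B → (∀ x → w x ≤ℚ B) → ∀ xs → ∑ xs w ≤ℚ fromℕ (length xs) * B
∑≤length* w B w≤B []       = ℚP.≤-reflexive (sym (ℚP.*-zeroˡ B))
∑≤length* w B w≤B (x ∷ xs) = ℚP.≤-trans (ℚP.+-mono-≤ (w≤B x) (∑≤length* w B w≤B xs))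
  (ℚP.≤-reflexive (solve 2 (λ B l → B :+ l :* B := (con 1ℚ :+ l) :* B) refl B (fromℕ (length xs))))

∣altSign∣ : ∀ {v} (S : Subset v) → ∣ altSign S ∣ ≡ 1ℚ
∣altSign∣ []          = refl
∣altSign∣ (true ∷ S)  = trans (ℚP.∣-p∣≡∣p∣ (altSign S)) (∣altSign∣ S)
∣altSign∣ (false ∷ S) = ∣altSign∣ S

module _ {ℓ k n′} (enc : Encoder ℓ k (suc n′)) (i : Fin k) (dec : ∀ J → Dec (IsRetrieval enc i J))
         {v} (A : Fin v → Subset (suc n′))
         (R-covers : ∀ J → ⌊ dec J ⌋ ≡ does (any? (λ j → A j ⊆? J)))
         (disjoint : ∀ j j′ → j ≢ j′ → A j ∩ A j′ ≡ ⊥) where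

  open CouponCollector n′
  open Bounds n′

  private
    L = allSubsets v

  gap-closed : ∀ K → partialExpectation enc i dec (suc K) - formula n v A ≡
                     ∑[ S ← L ] altSign S * remainder (# ⋃ A S) K
  gap-closed K = begin
    partialExpectation enc i dec (suc K) - formula n v A
      ≡⟨ cong₂ _-_ (partialExpectation-closed enc i dec A R-covers K) (formula-closed n v A disjoint) ⟩
    (∑[ S ← L ] altSign S * (rem S - N * h S)) - N * (∑[ S ← L ] (- altSign S) * h S)
      ≡⟨ cong (λ x → (∑[ S ← L ] altSign S * (rem S - N * h S)) - x) (∑-*ˡ N _ L) ⟨
    (∑[ S ← L ] altSign S * (rem S - N * h S)) - (∑[ S ← L ] N * ((- altSign S) * h S))
      ≡⟨ ∑-- _ _ L ⟨
    ∑[ S ← L ] (altSign S * (rem S - N * h S) - N * ((- altSign S) * h S))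
      ≡⟨ ∑-cong (λ S → solve 4 (λ s r N h → s :* (r :- N :* h) :- N :* ((:- s) :* h) := s :* r) refl
                        (altSign S) (rem S) N (h S)) L ⟩
    ∑[ S ← L ] altSign S * rem S ∎
    where
    open ≡-Reasoning
    N = fromℕ n
    h rem : Subset v → ℚ
    h S = H (# ⋃ A S)
    rem S = remainder (# ⋃ A S) K

  gap≤ : ∀ K → ∣ partialExpectation enc i dec (suc K) - formula n v A ∣ ≤ℚ
               probOf (length L ℕ.* (n ℕ.* ((K ℕ.+ n) ℕ.* n′ ℕ.^ K))) n K
  gap≤ K = begin
    ∣ partialExpectation enc i dec (suc K) - formula n v A ∣
      ≡⟨ cong ∣_∣ (gap-closed K) ⟩
    ∣ ∑[ S ← L ] altSign S * remainder (# ⋃ A S) K ∣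
      ≤⟨ ∣∑±∣≤∑ altSign (λ S → remainder (# ⋃ A S) K) ∣altSign∣ (λ S → 0≤remainder (# ⋃ A S) K) L ⟩
    ∑[ S ← L ] remainder (# ⋃ A S) K
      ≤⟨ ∑≤length* _ B (λ S → remainder≤ (# ⋃ A S) K (∣p∣≤n (⋃ A S))) L ⟩
    fromℕ (length L) * B
      ≡⟨ solve 6 (λ l N k M a ν → l :* (N :* ((k :+ M) :* (a :* ν))) := l :* (N :* ((k :+ M) :* a)) :* ν) refl
           (fromℕ (length L)) (fromℕ n) (fromℕ K) (fromℕ n) (fromℕ (n′ ℕ.^ K)) (recip n ^ K) ⟩
    fromℕ (length L) * (fromℕ n * ((fromℕ K + fromℕ n) * fromℕ (n′ ℕ.^ K))) * recip n ^ K
      ≡⟨ cong (_* recip n ^ K) (sym homo) ⟩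
    fromℕ c * recip n ^ K
      ≡⟨ probOf≡ c n K ⟨
    probOf c n K ∎
    where
    open ℚP.≤-Reasoning
    B = fromℕ n * ((fromℕ K + fromℕ n) * avoidProb K)
    c = length L ℕ.* (n ℕ.* ((K ℕ.+ n) ℕ.* n′ ℕ.^ K))
    homo : fromℕ c ≡ fromℕ (length L) * (fromℕ n * ((fromℕ K + fromℕ n) * fromℕ (n′ ℕ.^ K)))
    homo = begin-equality
      fromℕ (length L ℕ.* (n ℕ.* ((K ℕ.+ n) ℕ.* n′ ℕ.^ K)))
        ≡⟨ fromℕ-* (length L) (n ℕ.* ((K ℕ.+ n) ℕ.* n′ ℕ.^ K)) ⟩
      fromℕ (length L) * fromℕ (n ℕ.* ((K ℕ.+ n) ℕ.* n′ ℕ.^ K))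
        ≡⟨ cong (fromℕ (length L) *_) (fromℕ-* n ((K ℕ.+ n) ℕ.* n′ ℕ.^ K)) ⟩
      fromℕ (length L) * (fromℕ n * fromℕ ((K ℕ.+ n) ℕ.* n′ ℕ.^ K))
        ≡⟨ cong (λ x → fromℕ (length L) * (fromℕ n * x)) (fromℕ-* (K ℕ.+ n) (n′ ℕ.^ K)) ⟩
      fromℕ (length L) * (fromℕ n * (fromℕ (K ℕ.+ n) * fromℕ (n′ ℕ.^ K)))
        ≡⟨ cong (λ x → fromℕ (length L) * (fromℕ n * (x * fromℕ (n′ ℕ.^ K)))) (fromℕ-+ K n) ⟩
      fromℕ (length L) * (fromℕ n * ((fromℕ K + fromℕ n) * fromℕ (n′ ℕ.^ K))) ∎

  partialExpectation→formula : ∀ ε → 0ℚ < ε →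
    ∃ λ N → ∀ M → M ≥ N → ∣ partialExpectation enc i dec M - formula n v A ∣ ≤ℚ ε
  partialExpectation→formula ε 0<ε = suc K₀ , converges
    where
    c = length L ℕ.* n ℕ.* ℚ.↧ₙ ε
    -- From K₀ on, the bound of gap≤ is at most 1/↧ε by C*[K+n]*a^K≤n^K.
    K₀ = 2 ℕ.* c ℕ.* n ℕ.^ 3
    converges : ∀ M → M ≥ suc K₀ → ∣ partialExpectation enc i dec M - formula n v A ∣ ≤ℚ ε
    converges (suc K) (s≤s K₀≤K) = ℚP.≤-trans (gap≤ K)
      (/≤ ε 0<ε (length L ℕ.* (n ℕ.* ((K ℕ.+ n) ℕ.* n′ ℕ.^ K))) (n ℕ.^ K) {{ℕP.m^n≢0 n K}}
        (subst (ℕ._≤ n ℕ.^ K) (reassoc (length L) n (ℚ.↧ₙ ε) (K ℕ.+ n) (n′ ℕ.^ K))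
          (C*[K+n]*a^K≤n^K n′ c K (ℕP.m≤n⇒m≤1+n K₀≤K))))
      where
      reassoc : ∀ l n q a b → l ℕ.* n ℕ.* q ℕ.* (a ℕ.* b) ≡ l ℕ.* (n ℕ.* (a ℕ.* b)) ℕ.* q
      reassoc = solve-∀

gap-n≡0 : ∀ {ℓ k} (enc : Encoder ℓ k 0) i dec v (A : Fin v → Subset 0) M →
  ∣ partialExpectation enc i dec M - formula 0 v A ∣ ≡ 0ℚ
gap-n≡0 enc i dec v A M = cong₂ (λ a b → ∣ a - b ∣) (partialExpectation≡0 M) formula≡0
  where
  partialExpectation≡0 : ∀ M → partialExpectation enc i dec M ≡ 0ℚ
  partialExpectation≡0 zero    = refl
  partialExpectation≡0 (suc M) rewrite partialExpectation≡0 M =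
    solve 1 (λ x → con 0ℚ :+ x :* con 0ℚ := con 0ℚ) refl (ℤ.+ M ℚ./ 1)
  formula≡0 : formula 0 v A ≡ 0ℚ
  formula≡0 = ℚP.*-zeroˡ (sumℚ (List.map (λ s → signOf s * sumℚ (List.map (λ S → H (sizeSum A S))
    (List.filter (λ S → # S ℕ.≟ s) (allSubsets v)))) (List.map suc (List.upTo v))))

corollary1 : ∀ {ℓ k n : ℕ} → 1 ≤ ℓ →
  (enc : Encoder ℓ k n) → Injective enc →
  (i : Fin k) →
  (v : ℕ) (Aₛ : Fin v → Subset n) →
  (∀ j → IsMinimalRetrieval enc i (Aₛ j)) →
  (∀ B → IsMinimalRetrieval enc i B → ∃ λ j → B ≡ Aₛ j) →
  (∀ j j′ → Aₛ j ≡ Aₛ j′ → j ≡ j′) →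
  (∀ j j′ → j ≢ j′ → Aₛ j ∩ Aₛ j′ ≡ ⊥) →
  (dec : ∀ J → Dec (IsRetrieval enc i J)) →
  ∀ (ε : ℚ) → 0ℚ < ε →
    ∃ λ N → ∀ M → M ≥ N →
      ∣ partialExpectation enc i dec M - formula n v Aₛ ∣ ≤ℚ ε
corollary1 {n = zero} _ enc _ i v Aₛ _ _ _ _ dec ε 0<ε =
  0 , λ M _ → subst (_≤ℚ ε) (sym (gap-n≡0 enc i dec v Aₛ M)) (ℚP.<⇒≤ 0<ε)
corollary1 {n = suc n′} _ enc _ i v Aₛ Aₛ-minimal Aₛ-complete _ disjoint dec =
  partialExpectation→formula enc i dec Aₛ (⌊retrieval⌋ enc i dec Aₛ Aₛ-minimal Aₛ-complete) disjoint
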